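{- Let $F$ be a strictly 1-balanced graph on $r>2$ vertices. Then every clean d-cycle is strictly balanced: if $G$ is a clean d-cycle and $S$ is a proper sub-d-graph of $G$ with $v(S)\ge 1$, then $e(S)/v(S)<e(G)/v(G)$.
   Context: $F$ strictly 1-balanced means $d_1(S)<d_1(F)$ for every proper subgraph $S\subsetneq F$ with at least two vertices, where $d_1(S)=e(S)/(v(S)-1)$. An $F$-graph is a vertex set together with a set of $F$-edges, i.e. copies of $F$ (graphs isomorphic to $F$) on vertices from that set; its shadow graph is the graph on the same vertices whose edges are the union of the edges of its $F$-edges. For $k>2$, a clean $F$-cycle of length $k$ is an $F$-graph whose $F$-edges can be ordered $h_1,\dots,h_k$ such that there are distinct vertices $v_1,\dots,v_k$ with $h_i$ and $h_{i+1}$ having exactly the vertex $v_i$ in common for all $i\le k$ (with $h_{k+1}=h_1$), and $h_i,h_j$ sharing no vertices otherwise. A clean $F$-cycle of length $2$ is an $F$-graph with exactly two $F$-edges that share exactly two vertices. A clean $F$-cycle is sparse if it has length $2$ and the two shared vertices $v_1,v_2$ form an edge $\{v_1,v_2\}$ in both $F$-edges; otherwise it is dense. A d-graph $G=(V,U\cup D)$ consists of a vertex set $V$, a set $U$ of usual edges (2-element subsets of $V$), and a set $D$ of dummy edges, each dummy edge being a sparse clean $F$-cycle with vertices in $V$. $v(G)=|V|$ and $e(G)=|U\cup D|$ (dummy edges count as edges). A clean d-cycle is a d-graph $G=(V,U\cup D)$ such that either $(V,U)$ is the shadow graph of a dense clean $F$-cycle and $D=\emptyset$, or $(V,U)$ is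 the shadow graph of a sparse clean $F$-cycle $C$ and $D=\{C\}$. A sub-d-graph $S=(V',U'\cup D')$ of $G$ has $V'\subseteq V$, $U'\subseteq U$ with all edges of $U'$ inside $V'$, and $D'\subseteq D$ with the vertex set of each dummy edge in $D'$ contained in $V'$; it is proper if $S\ne G$. -}

module Defs where

open import Data.Nat using (ℕ; zero; suc; _+_; _*_; _∸_; _<_; _≤_; _<ᵇ_)
open import Data.Nat.DivMod using (_mod_)
open import Data.Fin using (Fin; toℕ)
open import Data.Bool using (Bool; true; false; if_then_else_; _∧_)
open import Data.List using (List; []; _∷_; [_]; map; length; allFin)
open import Data.Nat.ListAction using (sum)
open import Data.List.Relation.Unary.All using (All)
open import Data.List.Relation.Binary.Sublist.Propositional using (_⊆_)
open import Data.Product using (Σ; ∃; ∃-syntax; _×_; _,_)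
open import Data.Sum using (_⊎_)
open import Relation.Nullary using (¬_)
open import Relation.Binary.PropositionalEquality using (_≡_; _≢_)
open import Function.Bundles using (_⇔_)
open import Function.Definitions using (Injective)

vcount : ∀ {n} → (Fin n → Bool) → ℕ
vcount {n} W = sum (map (λ i → if W i then 1 else 0) (allFin n))

edgeCount : ∀ {n} → (Fin n → Fin n → Bool) → ℕ
edgeCount {n} A =
  sum (map (λ i → sum (map (λ j → if (toℕ i <ᵇ toℕ j) ∧ A i j then 1 else 0)
                            (allFin n)))
           (allFin n))

record SimpleGraph (r : ℕ) : Set where
  field
    adj    : Fin r → Fin r → Bool
    sym    : ∀ u w → adj u w ≡ adj w u
    irrefl : ∀ u → adj u u ≡ false
open SimpleGraph public

-- F strictly 1-balanced: every proper subgraph S (vertex set W, edge set E)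
-- with v(S) ≥ 2 has  e(S)/(v(S)-1) < e(F)/(v(F)-1)  (cross-multiplied).
Strictly1Balanced : ∀ {r} → SimpleGraph r → Set
Strictly1Balanced {r} F =
  (W : Fin r → Bool) (E : Fin r → Fin r → Bool) →
  (∀ u w → E u w ≡ E w u) →
  (∀ u w → E u w ≡ true → adj F u w ≡ true) →
  (∀ u w → E u w ≡ true → W u ≡ true × W w ≡ true) →
  ¬ ((∀ u → W u ≡ true) × (∀ u w → E u w ≡ adj F u w)) →
  2 ≤ vcount W →
  edgeCount E * (r ∸ 1) < edgeCount (adj F) * (vcount W ∸ 1)

-- F-edges (copies of F) in vertex set Fin n, given by an embedding
-- φ : Fin r → Fin n; the copy has vertices im φ and edges {φ a, φ b}, ab ∈ E(F).

InImg : ∀ {r n} → (Fin r → Fin n) → Fin n → Set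
InImg φ u = ∃[ a ] φ a ≡ u

Common : ∀ {r n} → (Fin r → Fin n) → (Fin r → Fin n) → Fin n → Set
Common φ ψ u = InImg φ u × InImg ψ u

EdgeIn : ∀ {r n} → SimpleGraph r → (Fin r → Fin n) → Fin n → Fin n → Set
EdgeIn F φ u w = ∃[ a ] ∃[ b ] (adj F a b ≡ true × φ a ≡ u × φ b ≡ w)

next : ∀ {k} → Fin k → Fin k
next {suc m} i = suc (toℕ i) mod suc m

LongShape : ∀ {r n} (k : ℕ) → (Fin k → Fin r → Fin n) → Set
LongShape {n = n} k h =
  2 < k ×
  (∃[ v ] (Injective _≡_ _≡_ v ×
     (∀ (i : Fin k) u → Common (h i) (h (next i)) u ⇔ (u ≡ v i))))
  × (∀ (i j : Fin k) → i ≢ j → j ≢ next i → i ≢ next j →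
       ∀ u → ¬ Common (h i) (h j) u)

TwoShape : ∀ {r n} (k : ℕ) → (Fin k → Fin r → Fin n) → Set
TwoShape {n = n} k h =
  k ≡ 2 ×
  (∀ (i j : Fin k) → i ≢ j →
     ∃[ v₁ ] ∃[ v₂ ] (v₁ ≢ v₂ ×
       (∀ u → Common (h i) (h j) u ⇔ (u ≡ v₁ ⊎ u ≡ v₂))))

-- A clean F-cycle whose F-edges h 0, …, h (k-1) have vertices in Fin n.
-- (Its own vertex set is the union of the vertex sets of its F-edges.)
record CleanFCycle {r} (F : SimpleGraph r) (n : ℕ) : Set where
  field
    k     : ℕ
    h     : Fin k → Fin r → Fin n
    emb   : ∀ i → Injective _≡_ _≡_ (h i)
    shape : LongShape k h ⊎ TwoShape k h
open CleanFCycle public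

InCycle : ∀ {r n} {F : SimpleGraph r} → CleanFCycle F n → Fin n → Set
InCycle C u = ∃[ i ] InImg (h C i) u

Sparse : ∀ {r n} {F : SimpleGraph r} → CleanFCycle F n → Set
Sparse {F = F} C =
  k C ≡ 2 ×
  (∀ i j → i ≢ j → ∀ u w → u ≢ w →
     Common (h C i) (h C j) u → Common (h C i) (h C j) w →
     EdgeIn F (h C i) u w)

Dense : ∀ {r n} {F : SimpleGraph r} → CleanFCycle F n → Set
Dense C = ¬ Sparse C

IsShadow : ∀ {r n} {F : SimpleGraph r} → CleanFCycle F n →
           (Fin n → Fin n → Bool) → Set
IsShadow {F = F} C U =
  (∀ u → InCycle C u) ×
  (∀ u w → (U u w ≡ true) ⇔ (∃[ i ] EdgeIn F (h C i) u w))

DummyEdge : ∀ {r} → SimpleGraph r → ℕ → Set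
DummyEdge F n = Σ (CleanFCycle F n) Sparse

record DGraph {r} (F : SimpleGraph r) (n : ℕ) : Set where
  field
    U      : Fin n → Fin n → Bool
    Usym   : ∀ u w → U u w ≡ U w u
    Uirr   : ∀ u → U u u ≡ false
    D      : List (DummyEdge F n)
open DGraph public

vG : ∀ {r n} {F : SimpleGraph r} → DGraph F n → ℕ
vG {n = n} G = n

eG : ∀ {r n} {F : SimpleGraph r} → DGraph F n → ℕ
eG G = edgeCount (U G) + length (D G)

IsCleanDCycle : ∀ {r n} {F : SimpleGraph r} → DGraph F n → Set
IsCleanDCycle {n = n} {F = F} G =
  Σ (CleanFCycle F n) λ C → IsShadow C (U G) ×
    ((Dense C × D G ≡ []) ⊎ (Σ (Sparse C) λ sp → D G ≡ [ (C , sp) ]))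

record SubDGraph {r n} {F : SimpleGraph r} (G : DGraph F n) : Set where
  field
    V'     : Fin n → Bool
    U'     : Fin n → Fin n → Bool
    U'sym  : ∀ u w → U' u w ≡ U' w u
    U'⊆U   : ∀ u w → U' u w ≡ true → U G u w ≡ true
    U'in   : ∀ u w → U' u w ≡ true → V' u ≡ true × V' w ≡ true
    D'     : List (DummyEdge F n)
    D'⊆D   : D' ⊆ D G
    D'in   : All (λ d → ∀ u → InCycle (Data.Product.proj₁ d) u → V' u ≡ true) D'
open SubDGraph public

vS : ∀ {r n} {F : SimpleGraph r} {G : DGraph F n} → SubDGraph G → ℕ
vS S = vcount (V' S)

eS : ∀ {r n} {F : SimpleGraph r} {G : DGraph F n} → SubDGraph G → ℕ
eS S = edgeCount (U' S) + length (D' S)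

Proper : ∀ {r n} {F : SimpleGraph r} {G : DGraph F n} → SubDGraph G → Set
Proper {G = G} S =
  ¬ ((∀ u → V' S u ≡ true) × (∀ u w → U' S u w ≡ U G u w) × D' S ≡ D G)

{-# OPTIONS --safe #-}
module Submission where

-- Write m = e(F) and q = r - 1. The k F-edges of a clean F-cycle are injective copies h i of F,
-- consecutive ones sharing a junction vertex v i (for k = 2 the junctions are the two shared
-- vertices). Every vertex lies in one copy, or in two if it is a junction, so n = k q; the copies
-- are edge-disjoint except for the common edge of a sparse 2-cycle, which the dummy edge replaces,
-- so e(G) ≥ k m. It therefore suffices to show e(S) q < m v(S), unless S spans G, in which case
-- properness gives e(S) < e(G).
-- S meets h i in a subgraph of F with x i vertices and y i edges, and strict 1-balancedness gives
-- y i q + m ≤ m x i once x i ≥ 1, strictly if x i ≥ 2 and that subgraph is not all of F. Summing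
-- over the copies, e(S) q ≤ m (v(S) + J - P), where J counts the junctions in S and P the copies
-- S meets; J ≤ P since v i lies in h i. If J = P, going around the cycle puts every junction in S,
-- hence two in each copy, so a copy not contained in S makes the bound strict; and if S contains
-- every copy, it spans G.

import Algebra.Properties.CommutativeSemigroup as CommutativeSemigroupProperties
import Algebra.Properties.Semiring.Sum as SemiringSum
open import Data.Bool using (Bool; true; false; if_then_else_; _∧_; T)
open import Data.Bool.Properties using (∧-zeroʳ) renaming (_≟_ to _≟ᵇ_)
open import Data.Empty using (⊥; ⊥-elim)
open import Data.Fin using (Fin; zero; suc; toℕ; fromℕ; inject₁)
open import Data.Fin.Induction using (<-weakInduction; <-weakInduction-startingFrom)
import Data.Fin.Properties as Finₚ
open import Data.Fin.Relation.Unary.Top using (view; ‵fromℕ; ‵inj₁)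
open import Data.List using (List; []; _∷_; [_]; map; allFin; tabulate; length)
open import Data.List.Properties using (map-tabulate)
open import Data.List.Relation.Binary.Sublist.Heterogeneous.Core using ([]; _∷_; _∷ʳ_)
open import Data.List.Relation.Binary.Sublist.Propositional using (_⊆_)
open import Data.List.Relation.Unary.All using (All; _∷_)
open import Data.Nat
open import Data.Nat.DivMod using (_%_; m<n⇒m%n≡m; n%n≡0)
import Data.Nat.ListAction as List
open import Data.Nat.Properties
open import Data.Product using (Σ; ∃; ∃-syntax; _×_; _,_; proj₁; proj₂)
open import Data.Sum using (_⊎_; inj₁; inj₂; swap)
open import Function.Base using (_∘_)
open import Function.Bundles using (Equivalence; _⇔_)
open import Function.Definitions using (Injective)
open import Relation.Binary.Definitions using (tri<; tri≈; tri>)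
open import Relation.Binary.PropositionalEquality
  using (_≡_; _≢_; refl; sym; trans; cong; cong₂; subst; subst₂; module ≡-Reasoning)
open import Relation.Nullary using (¬_; Dec; yes; no; does)
open import Relation.Nullary.Decidable using (_×-dec_)

open import Defs hiding (sym)

open Finₚ using () renaming (_≟_ to _≟ᶠ_)
open CommutativeSemigroupProperties *-commutativeSemigroup using (x∙yz≈y∙xz)
open SemiringSum +-*-semiring
  using (sum; sum-cong-≗; *-distribˡ-sum; *-distribʳ-sum)
  renaming (∑-distrib-+ to sum-distrib-+; ∑-comm to sum-comm)

χ : Bool → ℕ
χ b = if b then 1 else 0

χ≤1 : ∀ b → χ b ≤ 1
χ≤1 true  = ≤-refl
χ≤1 false = z≤n

χ-pos⇒true : ∀ {b} → 1 ≤ χ b → b ≡ true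
χ-pos⇒true {true} _ = refl

χ-∧ : ∀ a b → χ (a ∧ b) ≡ χ a * χ b
χ-∧ true  b = sym (*-identityˡ (χ b))
χ-∧ false b = refl

∧-true⇒ : ∀ {a b} → a ∧ b ≡ true → a ≡ true × b ≡ true
∧-true⇒ {true} b≡true = refl , b≡true

⊆-false : ∀ {a b : Bool} → (a ≡ true → b ≡ true) → b ≡ false → a ≡ false
⊆-false {false} _   _    = refl
⊆-false {true}  a⇒b refl with () ← a⇒b refl

δ : ∀ {n} → Fin n → Fin n → ℕ
δ a b = χ (does (a ≟ᶠ b))

δ-refl : ∀ {n} (a : Fin n) → δ a a ≡ 1
δ-refl a with a ≟ᶠ a
... | yes _  = refl
... | no a≢a = ⊥-elim (a≢a refl)

δ-≢ : ∀ {n} {a b : Fin n} → a ≢ b → δ a b ≡ 0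
δ-≢ {a = a} {b} a≢b with a ≟ᶠ b
... | yes a≡b = ⊥-elim (a≢b a≡b)
... | no _    = refl

δ-sym : ∀ {n} (a b : Fin n) → δ a b ≡ δ b a
δ-sym a b with a ≟ᶠ b | b ≟ᶠ a
... | yes _   | yes _   = refl
... | no _    | no _    = refl
... | yes a≡b | no b≢a  = ⊥-elim (b≢a (sym a≡b))
... | no a≢b  | yes b≡a = ⊥-elim (a≢b (sym b≡a))

δ≤1 : ∀ {n} (a b : Fin n) → δ a b ≤ 1
δ≤1 a b = χ≤1 (does (a ≟ᶠ b))

δ*-pos : ∀ {n} {a b : Fin n} x → 1 ≤ δ a b * x → a ≡ b × 1 ≤ x
δ*-pos {a = a} {b} x pos with a ≟ᶠ b
... | yes a≡b = a≡b , subst (1 ≤_) (*-identityˡ x) pos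
... | no _ with () ← pos

-- ∑ is opaque so that unification reads n and f off ∑ n f: the library's sum unfolds to a
-- fold that is stuck on an unknown n, and the sizes of sums over λ-terms go uninferred.
opaque
  ∑ : ∀ n → (Fin n → ℕ) → ℕ
  ∑ n f = sum f

  syntax ∑ n (λ i → e) = ∑[ i < n ] e

  ∑-cong : ∀ {n} {f g : Fin n → ℕ} → (∀ i → f i ≡ g i) → ∑ n f ≡ ∑ n g
  ∑-cong = sum-cong-≗

  ∑-distrib-+ : ∀ {n} (f g : Fin n → ℕ) → ∑[ i < n ] (f i + g i) ≡ ∑ n f + ∑ n g
  ∑-distrib-+ = sum-distrib-+

  ∑-comm : ∀ {m n} (f : Fin m → Fin n → ℕ) →
           ∑[ i < m ] ∑[ j < n ] f i j ≡ ∑[ j < n ] ∑[ i < m ] f i j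
  ∑-comm = sum-comm

  ∑-*ˡ : ∀ {n} c (f : Fin n → ℕ) → ∑[ i < n ] (c * f i) ≡ c * ∑ n f
  ∑-*ˡ c f = sym (*-distribˡ-sum c f)

  ∑-*ʳ : ∀ {n} c (f : Fin n → ℕ) → ∑[ i < n ] (f i * c) ≡ ∑ n f * c
  ∑-*ʳ c f = sym (*-distribʳ-sum c f)

  ∑-const : ∀ n c → ∑[ i < n ] c ≡ n * c
  ∑-const zero    c = refl
  ∑-const (suc n) c = cong (c +_) (∑-const n c)

  ∑-Fin2 : (f : Fin 2 → ℕ) → ∑[ i < 2 ] f i ≡ f zero + f (suc zero)
  ∑-Fin2 f = cong (f zero +_) (+-identityʳ (f (suc zero)))

  sum-allFin : ∀ {n} (f : Fin n → ℕ) → List.sum (map f (allFin n)) ≡ ∑ n f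
  sum-allFin f = trans (cong List.sum (map-tabulate (λ i → i) f)) (sum-tabulate f)
    where
    sum-tabulate : ∀ {n} (f : Fin n → ℕ) → List.sum (tabulate f) ≡ ∑ n f
    sum-tabulate {zero}  f = refl
    sum-tabulate {suc n} f = cong (f zero +_) (sum-tabulate (f ∘ suc))

  ∑-mono-≤ : ∀ {n} {f g : Fin n → ℕ} → (∀ i → f i ≤ g i) → ∑ n f ≤ ∑ n g
  ∑-mono-≤ {zero}  f≤g = z≤n
  ∑-mono-≤ {suc n} f≤g = +-mono-≤ (f≤g zero) (∑-mono-≤ (f≤g ∘ suc))

  ∑-mono-< : ∀ {n} {f g : Fin n → ℕ} → (∀ i → f i ≤ g i) → ∀ j → f j < g j → ∑ n f < ∑ n g
  ∑-mono-< f≤g zero    fj<gj = +-mono-<-≤ fj<gj (∑-mono-≤ (f≤g ∘ suc))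
  ∑-mono-< f≤g (suc j) fj<gj = +-mono-≤-< (f≤g zero) (∑-mono-< (f≤g ∘ suc) j fj<gj)

  term≤∑ : ∀ {n} (f : Fin n → ℕ) i → f i ≤ ∑ n f
  term≤∑ f zero    = m≤m+n _ _
  term≤∑ f (suc i) = ≤-trans (term≤∑ (f ∘ suc) i) (m≤n+m _ _)

  two-terms≤∑ : ∀ {n} (f : Fin n → ℕ) {i j} → i ≢ j → f i + f j ≤ ∑ n f
  two-terms≤∑ f {zero}  {zero}  i≢j = ⊥-elim (i≢j refl)
  two-terms≤∑ f {zero}  {suc j} _   = +-monoʳ-≤ (f zero) (term≤∑ (f ∘ suc) j)
  two-terms≤∑ f {suc i} {zero}  _   =
    ≤-trans (≤-reflexive (+-comm (f (suc i)) (f zero))) (+-monoʳ-≤ (f zero) (term≤∑ (f ∘ suc) i))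
  two-terms≤∑ f {suc i} {suc j} i≢j =
    ≤-trans (two-terms≤∑ (f ∘ suc) (i≢j ∘ cong suc)) (m≤n+m _ _)

  ∑-pos⇒∃ : ∀ {n} (f : Fin n → ℕ) → 1 ≤ ∑ n f → ∃[ i ] 1 ≤ f i
  ∑-pos⇒∃ {suc n} f pos with f zero in f0
  ... | suc _ = zero , subst (1 ≤_) (sym f0) (s≤s z≤n)
  ... | zero with ∑-pos⇒∃ (f ∘ suc) pos
  ...   | i , fi-pos = suc i , fi-pos

  ∑-zero : ∀ {n} {f : Fin n → ℕ} → (∀ i → f i ≡ 0) → ∑ n f ≡ 0
  ∑-zero {n} f≗0 = trans (∑-cong f≗0) (trans (∑-const n 0) (*-zeroʳ n))

  ∑≤1 : ∀ {n} (f : Fin n → ℕ) → (∀ i → f i ≤ 1) → (∀ i j → 1 ≤ f i → 1 ≤ f j → i ≡ j) →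
        ∑ n f ≤ 1
  ∑≤1 {zero}  f f≤1 unique = z≤n
  ∑≤1 {suc n} f f≤1 unique with f zero in f0
  ... | zero  = ∑≤1 (f ∘ suc) (f≤1 ∘ suc) (λ i j fi fj → Finₚ.suc-injective (unique (suc i) (suc j) fi fj))
  ... | suc y = begin
    suc y + ∑ n (f ∘ suc) ≡⟨ cong (suc y +_) (∑-zero rest≡0) ⟩
    suc y + 0             ≡⟨ +-identityʳ (suc y) ⟩
    suc y                 ≡⟨ f0 ⟨
    f zero                ≤⟨ f≤1 zero ⟩
    1                     ∎
    where
    open ≤-Reasoning
    rest≡0 : ∀ i → f (suc i) ≡ 0
    rest≡0 i with f (suc i) in fi
    ... | zero  = refl
    ... | suc _ with () ← unique zero (suc i) (subst (1 ≤_) (sym f0) (s≤s z≤n))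
                                            (subst (1 ≤_) (sym fi) (s≤s z≤n))

  ∑-δ : ∀ {n} (a : Fin n) (g : Fin n → ℕ) → ∑[ u < n ] (δ a u * g u) ≡ g a
  ∑-δ {suc n} zero g = begin
    1 * g zero + ∑[ u < n ] 0 ≡⟨ cong₂ _+_ (*-identityˡ (g zero)) (∑-zero {n} (λ _ → refl)) ⟩
    g zero + 0                ≡⟨ +-identityʳ (g zero) ⟩
    g zero                    ∎
    where open ≡-Reasoning
  ∑-δ {suc n} (suc a) g = ∑-δ a (g ∘ suc)

∑-δ₁ : ∀ {n} (a : Fin n) → ∑[ u < n ] δ a u ≡ 1
∑-δ₁ a = trans (∑-cong (λ u → sym (*-identityʳ _))) (∑-δ a (λ _ → 1))

∑∑-δδ : ∀ {n} (a b : Fin n) → ∑[ u < n ] ∑[ w < n ] (δ a u * δ b w) ≡ 1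
∑∑-δδ a b =
  trans (∑-cong (λ u → trans (∑-*ˡ (δ a u) (δ b)) (cong (δ a u *_) (∑-δ₁ b)))) (∑-δ a (λ _ → 1))

-- Opaque for the same reason: φ is read off pushforward φ f u.
opaque
  pushforward : ∀ {r n} → (Fin r → Fin n) → (Fin r → ℕ) → Fin n → ℕ
  pushforward {r} φ f u = ∑[ a < r ] (δ (φ a) u * f a)

  pushforward-def : ∀ {r n} (φ : Fin r → Fin n) f u → pushforward φ f u ≡ ∑[ a < r ] (δ (φ a) u * f a)
  pushforward-def φ f u = refl

  ∑-pushforward : ∀ {r n} (φ : Fin r → Fin n) (f : Fin r → ℕ) (g : Fin n → ℕ) →
                  ∑[ a < r ] (f a * g (φ a)) ≡ ∑[ u < n ] (pushforward φ f u * g u)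
  ∑-pushforward {r} {n} φ f g = begin
    ∑[ a < r ] (f a * g (φ a))
      ≡⟨ ∑-cong (λ a → cong (f a *_) (∑-δ (φ a) g)) ⟨
    ∑[ a < r ] (f a * ∑[ u < n ] (δ (φ a) u * g u))
      ≡⟨ ∑-cong (λ a → sym (∑-*ˡ (f a) _)) ⟩
    ∑[ a < r ] ∑[ u < n ] (f a * (δ (φ a) u * g u))
      ≡⟨ ∑-comm _ ⟩
    ∑[ u < n ] ∑[ a < r ] (f a * (δ (φ a) u * g u))
      ≡⟨ ∑-cong (λ u → ∑-cong (λ a → reassoc (f a) (δ (φ a) u) (g u))) ⟩
    ∑[ u < n ] ∑[ a < r ] (δ (φ a) u * f a * g u)
      ≡⟨ ∑-cong (λ u → ∑-*ʳ (g u) _) ⟩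
    ∑[ u < n ] (pushforward φ f u * g u)
      ∎
    where
    open ≡-Reasoning
    reassoc : ∀ x y z → x * (y * z) ≡ y * x * z
    reassoc x y z = trans (x∙yz≈y∙xz x y z) (sym (*-assoc y x z))

  pushforward-pos⇒∃ : ∀ {r n} (φ : Fin r → Fin n) f u → 1 ≤ pushforward φ f u →
                      ∃[ a ] φ a ≡ u × 1 ≤ f a
  pushforward-pos⇒∃ φ f u pos with ∑-pos⇒∃ _ pos
  ... | a , term-pos = a , δ*-pos (f a) term-pos

  pushforward-image : ∀ {r n} {φ : Fin r → Fin n} → Injective _≡_ _≡_ φ →
                      ∀ f a → pushforward φ f (φ a) ≡ f a
  pushforward-image {φ = φ} φ-inj f a =
    trans (∑-cong (λ b → cong (_* f b) (trans (δ-image b) (δ-sym b a)))) (∑-δ a f)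
    where
    δ-image : ∀ b → δ (φ b) (φ a) ≡ δ b a
    δ-image b with b ≟ᶠ a
    ... | yes refl = δ-refl (φ b)
    ... | no b≢a   = δ-≢ (b≢a ∘ φ-inj)

  pushforward≤1 : ∀ {r n} {φ : Fin r → Fin n} → Injective _≡_ _≡_ φ →
                  ∀ f → (∀ a → f a ≤ 1) → ∀ u → pushforward φ f u ≤ 1
  pushforward≤1 {φ = φ} φ-inj f f≤1 u = ∑≤1 _ (λ a → *-mono-≤ (δ≤1 (φ a) u) (f≤1 a)) unique
    where
    unique : ∀ a b → 1 ≤ δ (φ a) u * f a → 1 ≤ δ (φ b) u * f b → a ≡ b
    unique a b pa pb = φ-inj (trans (proj₁ (δ*-pos (f a) pa)) (sym (proj₁ (δ*-pos (f b) pb))))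

∑∑-pushforward : ∀ {r n} (φ : Fin r → Fin n) (K : Fin r → Fin r → ℕ) (H : Fin n → Fin n → ℕ) →
                 ∑[ a < r ] ∑[ b < r ] (K a b * H (φ a) (φ b)) ≡
                 ∑[ u < n ] ∑[ w < n ] (pushforward φ (λ a → pushforward φ (K a) w) u * H u w)
∑∑-pushforward {r} {n} φ K H = begin
  ∑[ a < r ] ∑[ b < r ] (K a b * H (φ a) (φ b))
    ≡⟨ ∑-cong (λ a → ∑-pushforward φ (K a) (H (φ a))) ⟩
  ∑[ a < r ] ∑[ w < n ] (pushforward φ (K a) w * H (φ a) w)
    ≡⟨ ∑-comm _ ⟩
  ∑[ w < n ] ∑[ a < r ] (pushforward φ (K a) w * H (φ a) w)
    ≡⟨ ∑-cong (λ w → ∑-pushforward φ _ (λ u → H u w)) ⟩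
  ∑[ w < n ] ∑[ u < n ] (pushforward φ (λ a → pushforward φ (K a) w) u * H u w)
    ≡⟨ ∑-comm _ ⟩
  ∑[ u < n ] ∑[ w < n ] (pushforward φ (λ a → pushforward φ (K a) w) u * H u w)
    ∎
  where open ≡-Reasoning

<ᵇ-true : ∀ {m n} → m < n → (m <ᵇ n) ≡ true
<ᵇ-true {m} {n} m<n with m <ᵇ n | <⇒<ᵇ m<n
... | true | _ = refl

<ᵇ-false : ∀ {m n} → n ≤ m → (m <ᵇ n) ≡ false
<ᵇ-false {m} {n} n≤m with m <ᵇ n in m<ᵇn
... | false = refl
... | true  = ⊥-elim (<⇒≱ (<ᵇ⇒< m n (subst T (sym m<ᵇn) _)) n≤m)

arcCount : ∀ {n} → (Fin n → Fin n → Bool) → ℕ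
arcCount {n} A = ∑[ i < n ] ∑[ j < n ] χ (A i j)

module _ {n} (A : Fin n → Fin n → Bool) where

  private
    ascending descending : Fin n → Fin n → ℕ
    ascending  i j = χ ((toℕ i <ᵇ toℕ j) ∧ A i j)
    descending i j = χ ((toℕ j <ᵇ toℕ i) ∧ A i j)

  edgeCount-∑ : edgeCount A ≡ ∑[ i < n ] ∑[ j < n ] ascending i j
  edgeCount-∑ = trans (sum-allFin (λ i → List.sum (map (ascending i) (allFin n))))
                      (∑-cong (λ i → sum-allFin (ascending i)))

  arcCount≡2*edgeCount : (∀ i j → A i j ≡ A j i) → (∀ i → A i i ≡ false) → arcCount A ≡ 2 * edgeCount A
  arcCount≡2*edgeCount A-sym A-irr = begin
    arcCount A
      ≡⟨ ∑-cong (λ i → trans (∑-cong (χ-split i)) (∑-distrib-+ {n} _ _)) ⟩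
    ∑[ i < n ] (∑[ j < n ] ascending i j + ∑[ j < n ] descending i j)
      ≡⟨ ∑-distrib-+ {n} _ _ ⟩
    E + ∑[ i < n ] ∑[ j < n ] descending i j
      ≡⟨ cong (E +_) (∑-comm descending) ⟩
    E + ∑[ j < n ] ∑[ i < n ] descending i j
      ≡⟨ cong (E +_) (∑-cong (λ j → ∑-cong (λ i → cong (λ t → χ ((toℕ j <ᵇ toℕ i) ∧ t)) (A-sym i j)))) ⟩
    E + E
      ≡⟨ cong (E +_) (+-identityʳ E) ⟨
    2 * E
      ≡⟨ cong (2 *_) edgeCount-∑ ⟨
    2 * edgeCount A
      ∎
    where
    open ≡-Reasoning
    E : ℕ
    E = ∑[ i < n ] ∑[ j < n ] ascending i j
    χ-split : ∀ i j → χ (A i j) ≡ ascending i j + descending i j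
    χ-split i j with <-cmp (toℕ i) (toℕ j)
    ... | tri< i<j _ _ rewrite <ᵇ-true i<j | <ᵇ-false (<⇒≤ i<j) = sym (+-identityʳ _)
    ... | tri> _ _ j<i rewrite <ᵇ-false (<⇒≤ j<i) | <ᵇ-true j<i = refl
    ... | tri≈ _ i≡j _ with refl ← Finₚ.toℕ-injective i≡j
      rewrite A-irr i | <ᵇ-false (≤-refl {toℕ i}) = refl

module _ {n} {W : Fin n → Bool} where

  vcount-∑ : vcount W ≡ ∑[ a < n ] χ (W a)
  vcount-∑ = sum-allFin (χ ∘ W)

  1≤vcount : ∀ {a} → W a ≡ true → 1 ≤ vcount W
  1≤vcount {a} Wa = subst₂ _≤_ (cong χ Wa) (sym vcount-∑) (term≤∑ (χ ∘ W) a)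

  2≤vcount : ∀ {a b} → a ≢ b → W a ≡ true → W b ≡ true → 2 ≤ vcount W
  2≤vcount a≢b Wa Wb =
    subst₂ _≤_ (cong₂ _+_ (cong χ Wa) (cong χ Wb)) (sym vcount-∑) (two-terms≤∑ (χ ∘ W) a≢b)

  vcount-full : (∀ a → W a ≡ true) → vcount W ≡ n
  vcount-full all = trans vcount-∑ (trans (∑-cong (cong χ ∘ all)) (trans (∑-const n 1) (*-identityʳ n)))

  vcount-pos⇒∃ : 1 ≤ vcount W → ∃[ a ] W a ≡ true
  vcount-pos⇒∃ pos with ∑-pos⇒∃ (χ ∘ W) (subst (1 ≤_) vcount-∑ pos)
  ... | a , χWa-pos = a , χ-pos⇒true χWa-pos

edgeCount-cong : ∀ {n} {A B : Fin n → Fin n → Bool} → (∀ a b → A a b ≡ B a b) → edgeCount A ≡ edgeCount B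
edgeCount-cong {A = A} {B} A≗B = begin
  edgeCount A
    ≡⟨ edgeCount-∑ A ⟩
  ∑[ a < _ ] ∑[ b < _ ] χ ((toℕ a <ᵇ toℕ b) ∧ A a b)
    ≡⟨ ∑-cong (λ a → ∑-cong (λ b → cong (λ t → χ ((toℕ a <ᵇ toℕ b) ∧ t)) (A≗B a b))) ⟩
  ∑[ a < _ ] ∑[ b < _ ] χ ((toℕ a <ᵇ toℕ b) ∧ B a b)
    ≡⟨ edgeCount-∑ B ⟨
  edgeCount B
    ∎
  where open ≡-Reasoning

edgeCount-empty : ∀ {n} {A : Fin n → Fin n → Bool} → (∀ a b → A a b ≡ false) → edgeCount A ≡ 0
edgeCount-empty {n} {A} A≗false = begin
  edgeCount A
    ≡⟨ edgeCount-cong A≗false ⟩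
  edgeCount {n} (λ _ _ → false)
    ≡⟨ edgeCount-∑ {n} (λ _ _ → false) ⟩
  ∑[ a < n ] ∑[ b < n ] χ ((toℕ a <ᵇ toℕ b) ∧ false)
    ≡⟨ ∑-zero {n} (λ a → ∑-zero {n} (λ b → cong χ (∧-zeroʳ (toℕ a <ᵇ toℕ b)))) ⟩
  0
    ∎
  where open ≡-Reasoning

edgeCount-< : ∀ {n} {A B : Fin n → Fin n → Bool} →
  (∀ u w → A u w ≡ A w u) → (∀ u → A u u ≡ false) →
  (∀ u w → B u w ≡ B w u) → (∀ u → B u u ≡ false) →
  (∀ u w → A u w ≡ true → B u w ≡ true) → ¬ (∀ u w → A u w ≡ B u w) → edgeCount A < edgeCount B
edgeCount-< {n} {A} {B} A-sym A-irr B-sym B-irr A⊆B A≢B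
  with Finₚ.¬∀⟶∃¬ n _ (λ u → Finₚ.all? (λ w → A u w ≟ᵇ B u w)) A≢B
... | u₀ , A≢B-row with Finₚ.¬∀⟶∃¬ n _ (λ w → A u₀ w ≟ᵇ B u₀ w) A≢B-row
...   | w₀ , A≢B-entry = *-cancelˡ-< 2 _ _ (begin-strict
  2 * edgeCount A ≡⟨ arcCount≡2*edgeCount A A-sym A-irr ⟨
  arcCount A      <⟨ ∑-mono-< (λ u → ∑-mono-≤ (χ-mono u)) u₀ (∑-mono-< (χ-mono u₀) w₀ χ-<) ⟩
  arcCount B      ≡⟨ arcCount≡2*edgeCount B B-sym B-irr ⟩
  2 * edgeCount B ∎)
  where
  open ≤-Reasoning
  χ-mono : ∀ u w → χ (A u w) ≤ χ (B u w)
  χ-mono u w with A u w in Auw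
  ... | false = z≤n
  ... | true  = ≤-reflexive (cong χ (sym (A⊆B u w Auw)))
  χ-< : χ (A u₀ w₀) < χ (B u₀ w₀)
  χ-< with A u₀ w₀ in Auw | B u₀ w₀ in Buw
  ... | false | true  = s≤s z≤n
  ... | false | false = ⊥-elim (A≢B-entry refl)
  ... | true  | _     = ⊥-elim (A≢B-entry (trans (sym (A⊆B u₀ w₀ Auw)) Buw))

module _ {m : ℕ} where

  toℕ-next : (i : Fin (suc m)) → toℕ (next i) ≡ suc (toℕ i) % suc m
  toℕ-next i = Finₚ.toℕ-fromℕ< _

  next-inject₁ : (j : Fin m) → next (inject₁ j) ≡ suc j
  next-inject₁ j = Finₚ.toℕ-injective (begin
    toℕ (next (inject₁ j))        ≡⟨ toℕ-next (inject₁ j) ⟩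
    suc (toℕ (inject₁ j)) % suc m ≡⟨ cong (λ t → suc t % suc m) (Finₚ.toℕ-inject₁ j) ⟩
    suc (toℕ j) % suc m           ≡⟨ m<n⇒m%n≡m (s≤s (Finₚ.toℕ<n j)) ⟩
    suc (toℕ j)                   ∎)
    where open ≡-Reasoning

  next-fromℕ : next (fromℕ m) ≡ zero
  next-fromℕ = Finₚ.toℕ-injective (begin
    toℕ (next (fromℕ m))        ≡⟨ toℕ-next (fromℕ m) ⟩
    suc (toℕ (fromℕ m)) % suc m ≡⟨ cong (λ t → suc t % suc m) (Finₚ.toℕ-fromℕ m) ⟩
    suc m % suc m               ≡⟨ n%n≡0 (suc m) ⟩
    0                           ∎)
    where open ≡-Reasoning

next-surjective : ∀ {k} (j : Fin k) → ∃[ i ] next i ≡ j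
next-surjective {suc m} zero    = fromℕ m , next-fromℕ
next-surjective {suc m} (suc j) = inject₁ j , next-inject₁ j

next-≢ : ∀ {k} → 2 ≤ k → (i : Fin k) → next i ≢ i
next-≢ {suc zero} (s≤s ()) _
next-≢ {suc (suc m)} _ i with view i
... | ‵fromℕ rewrite next-fromℕ {suc m} = λ ()
... | ‵inj₁ {i = j} _ rewrite next-inject₁ j =
  λ sj≡j → 1+n≢n (trans (cong toℕ sj≡j) (Finₚ.toℕ-inject₁ j))

cycle-induction : ∀ {k ℓ} (P : Fin k → Set ℓ) → (∀ i → P i → P (next i)) →
                  ∀ {i₀} → P i₀ → ∀ i → P i
cycle-induction {suc m} P step {i₀} Pi₀ = <-weakInduction P P-zero step-inject₁
  where
  step-inject₁ : ∀ j → P (inject₁ j) → P (suc j)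
  step-inject₁ j = subst P (next-inject₁ j) ∘ step (inject₁ j)
  P-last : P (fromℕ m)
  P-last = <-weakInduction-startingFrom P Pi₀ step-inject₁ (Finₚ.≤fromℕ i₀)
  P-zero : P zero
  P-zero = subst P next-fromℕ (step (fromℕ m) P-last)

record Subgraph {r} (F : SimpleGraph r) : Set where
  field
    W     : Fin r → Bool
    E     : Fin r → Fin r → Bool
    E-sym : ∀ a b → E a b ≡ E b a
    E⊆F   : ∀ a b → E a b ≡ true → adj F a b ≡ true
    E⊆W   : ∀ a b → E a b ≡ true → W a ≡ true × W b ≡ true

  IsWhole : Set
  IsWhole = (∀ a → W a ≡ true) × (∀ a b → E a b ≡ adj F a b)

  isWhole? : Dec IsWhole
  isWhole? = Finₚ.all? (λ a → W a ≟ᵇ true)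
       ×-dec Finₚ.all? (λ a → Finₚ.all? (λ b → E a b ≟ᵇ adj F a b))

adj⇒≢ : ∀ {r} (F : SimpleGraph r) {a b} → adj F a b ≡ true → a ≢ b
adj⇒≢ F {a} Fab refl with () ← trans (sym Fab) (irrefl F a)

module _ {r} {F : SimpleGraph r} (bal : Strictly1Balanced F) (S : Subgraph F) where
  open Subgraph S

  private
    m x y : ℕ
    m = edgeCount (adj F)
    x = vcount W
    y = edgeCount E

  density-< : 2 ≤ x → ¬ IsWhole → y * (r ∸ 1) + m * (x ⊓ 1) < m * x
  density-< 2≤x notWhole = begin-strict
    y * (r ∸ 1) + m * (x ⊓ 1) ≡⟨ cong (λ t → y * (r ∸ 1) + m * t) (m≥n⇒m⊓n≡n 1≤x) ⟩
    y * (r ∸ 1) + m * 1       <⟨ +-monoˡ-< (m * 1) (bal W E E-sym E⊆F E⊆W notWhole 2≤x) ⟩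
    m * (x ∸ 1) + m * 1       ≡⟨ *-distribˡ-+ m (x ∸ 1) 1 ⟨
    m * (x ∸ 1 + 1)           ≡⟨ cong (m *_) (m∸n+n≡m 1≤x) ⟩
    m * x                     ∎
    where
    open ≤-Reasoning
    1≤x : 1 ≤ x
    1≤x = ≤-trans (s≤s z≤n) 2≤x

  density-≤ : y * (r ∸ 1) + m * (x ⊓ 1) ≤ m * x
  density-≤ with 2 ≤? x | isWhole?
  ... | yes 2≤x | no notWhole = <⇒≤ (density-< 2≤x notWhole)
  ... | yes 2≤x | yes (allW , E≗F) = ≤-reflexive (begin
    y * (r ∸ 1) + m * (x ⊓ 1) ≡⟨ cong₂ (λ s t → s * (r ∸ 1) + m * (t ⊓ 1)) (edgeCount-cong E≗F) x≡r ⟩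
    m * (r ∸ 1) + m * (r ⊓ 1) ≡⟨ *-distribˡ-+ m (r ∸ 1) (r ⊓ 1) ⟨
    m * (r ∸ 1 + r ⊓ 1)       ≡⟨ cong (λ t → m * (r ∸ 1 + t)) (m≥n⇒m⊓n≡n 1≤r) ⟩
    m * (r ∸ 1 + 1)           ≡⟨ cong (m *_) (m∸n+n≡m 1≤r) ⟩
    m * r                     ≡⟨ cong (m *_) x≡r ⟨
    m * x                     ∎)
    where
    open ≡-Reasoning
    x≡r : x ≡ r
    x≡r = vcount-full allW
    1≤r : 1 ≤ r
    1≤r = subst (1 ≤_) x≡r (≤-trans (s≤s z≤n) 2≤x)
  ... | no x≱2 | _ = begin
    y * (r ∸ 1) + m * (x ⊓ 1) ≡⟨ cong (λ t → t * (r ∸ 1) + m * (x ⊓ 1)) (edgeCount-empty noEdge) ⟩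
    m * (x ⊓ 1)               ≤⟨ *-monoʳ-≤ m (m⊓n≤m x 1) ⟩
    m * x                     ∎
    where
    open ≤-Reasoning
    noEdge : ∀ a b → E a b ≡ false
    noEdge a b with E a b in Eab
    ... | false = refl
    ... | true  = ⊥-elim (x≱2 (2≤vcount (adj⇒≢ F (E⊆F a b Eab))
                                         (proj₁ (E⊆W a b Eab)) (proj₂ (E⊆W a b Eab))))

1≤edgeCount : ∀ {r} {F : SimpleGraph r} → Strictly1Balanced F → 2 < r → 1 ≤ edgeCount (adj F)
1≤edgeCount {suc (suc (suc r))} {F} bal (s≤s (s≤s (s≤s _))) =
  positive-factor (subst (_< edgeCount (adj F) * (vcount W ∸ 1)) 0*q≡0
                         (bal W E (λ _ _ → refl) (λ _ _ ()) (λ _ _ ()) notWhole 2≤vcountW))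
  where
  W : Fin (3 + r) → Bool
  W a = toℕ a <ᵇ 2
  E : Fin (3 + r) → Fin (3 + r) → Bool
  E _ _ = false
  notWhole : ¬ ((∀ a → W a ≡ true) × (∀ a b → E a b ≡ adj F a b))
  notWhole (allW , _) with () ← allW (suc (suc zero))
  2≤vcountW : 2 ≤ vcount W
  2≤vcountW = 2≤vcount {W = W} {a = zero} {b = suc zero} (λ ()) refl refl
  0*q≡0 : edgeCount E * (2 + r) ≡ 0
  0*q≡0 = cong (_* (2 + r)) (edgeCount-empty {A = E} (λ _ _ → refl))
  positive-factor : ∀ {m x} → 0 < m * x → 1 ≤ m
  positive-factor {suc _} _ = s≤s z≤n

trace : ∀ {r n} → SimpleGraph r → (Fin r → Fin n) → (Fin n → Fin n → Bool) → Fin r → Fin r → Bool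
trace F φ U a b = U (φ a) (φ b) ∧ adj F a b

fiberSize : ∀ {r n} → (Fin r → Fin n) → Fin n → ℕ
fiberSize φ = pushforward φ (λ _ → 1)

arcFiberSize : ∀ {r n} → SimpleGraph r → (Fin r → Fin n) → Fin n → Fin n → ℕ
arcFiberSize F φ u w = pushforward φ (λ a → pushforward φ (λ b → χ (adj F a b)) w) u

module _ {r n} {φ : Fin r → Fin n} where

  fiberSize-pos⇒InImg : ∀ {u} → 1 ≤ fiberSize φ u → InImg φ u
  fiberSize-pos⇒InImg {u} pos with pushforward-pos⇒∃ φ _ u pos
  ... | a , φa≡u , _ = a , φa≡u

  ∑-fiberSize : ∑[ u < n ] fiberSize φ u ≡ r
  ∑-fiberSize = begin
    ∑[ u < n ] fiberSize φ u       ≡⟨ ∑-cong (λ u → *-identityʳ (fiberSize φ u)) ⟨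
    ∑[ u < n ] (fiberSize φ u * 1) ≡⟨ ∑-pushforward φ (λ _ → 1) (λ _ → 1) ⟨
    ∑[ a < r ] 1                   ≡⟨ trans (∑-const r 1) (*-identityʳ r) ⟩
    r                              ∎
    where open ≡-Reasoning

  vcount-∘ : (V : Fin n → Bool) → vcount (V ∘ φ) ≡ ∑[ u < n ] (fiberSize φ u * χ (V u))
  vcount-∘ V =
    trans vcount-∑ (trans (∑-cong (λ a → sym (*-identityˡ _))) (∑-pushforward φ (λ _ → 1) (χ ∘ V)))

  arcFiberSize-pos⇒EdgeIn : (F : SimpleGraph r) → ∀ {u w} → 1 ≤ arcFiberSize F φ u w → EdgeIn F φ u w
  arcFiberSize-pos⇒EdgeIn F {u} {w} pos with pushforward-pos⇒∃ φ _ u pos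
  ... | a , φa≡u , pos′ with pushforward-pos⇒∃ φ _ w pos′
  ...   | b , φb≡w , Fab-pos = a , b , χ-pos⇒true Fab-pos , φa≡u , φb≡w

  module _ (φ-inj : Injective _≡_ _≡_ φ) where

    fiberSize≤1 : ∀ u → fiberSize φ u ≤ 1
    fiberSize≤1 = pushforward≤1 φ-inj (λ _ → 1) (λ _ → ≤-refl)

    InImg⇒fiberSize≡1 : ∀ {u} → InImg φ u → fiberSize φ u ≡ 1
    InImg⇒fiberSize≡1 (a , refl) = pushforward-image φ-inj _ a

    arcFiberSize≤1 : (F : SimpleGraph r) → ∀ u w → arcFiberSize F φ u w ≤ 1
    arcFiberSize≤1 F u w = pushforward≤1 φ-inj _ (λ a → pushforward≤1 φ-inj _ (λ b → χ≤1 (adj F a b)) w) u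

    EdgeIn⇒arcFiberSize≡1 : (F : SimpleGraph r) → ∀ {u w} → EdgeIn F φ u w → arcFiberSize F φ u w ≡ 1
    EdgeIn⇒arcFiberSize≡1 F (a , b , Fab , refl , refl) =
      trans (pushforward-image φ-inj _ a) (trans (pushforward-image φ-inj _ b) (cong χ Fab))

  module _ (F : SimpleGraph r) where

    ∑∑-arcFiberSize : ∑[ u < n ] ∑[ w < n ] arcFiberSize F φ u w ≡ 2 * edgeCount (adj F)
    ∑∑-arcFiberSize = begin
      ∑[ u < n ] ∑[ w < n ] arcFiberSize F φ u w
        ≡⟨ ∑-cong (λ u → ∑-cong (λ w → *-identityʳ _)) ⟨
      ∑[ u < n ] ∑[ w < n ] (arcFiberSize F φ u w * 1)
        ≡⟨ ∑∑-pushforward φ (λ a b → χ (adj F a b)) (λ _ _ → 1) ⟨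
      ∑[ a < r ] ∑[ b < r ] (χ (adj F a b) * 1)
        ≡⟨ ∑-cong (λ a → ∑-cong (λ b → *-identityʳ _)) ⟩
      arcCount (adj F)
        ≡⟨ arcCount≡2*edgeCount (adj F) (SimpleGraph.sym F) (irrefl F) ⟩
      2 * edgeCount (adj F)
        ∎
      where open ≡-Reasoning

    2*edgeCount-trace : (U : Fin n → Fin n → Bool) → (∀ u w → U u w ≡ U w u) →
      2 * edgeCount (trace F φ U) ≡ ∑[ u < n ] ∑[ w < n ] (arcFiberSize F φ u w * χ (U u w))
    2*edgeCount-trace U U-sym = begin
      2 * edgeCount (trace F φ U)
        ≡⟨ arcCount≡2*edgeCount (trace F φ U) trace-sym trace-irr ⟨
      arcCount (trace F φ U)
        ≡⟨ ∑-cong (λ a → ∑-cong (λ b → χ-trace a b)) ⟩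
      ∑[ a < r ] ∑[ b < r ] (χ (adj F a b) * χ (U (φ a) (φ b)))
        ≡⟨ ∑∑-pushforward φ (λ a b → χ (adj F a b)) (λ u w → χ (U u w)) ⟩
      ∑[ u < n ] ∑[ w < n ] (arcFiberSize F φ u w * χ (U u w))
        ∎
      where
      open ≡-Reasoning
      χ-trace : ∀ a b → χ (trace F φ U a b) ≡ χ (adj F a b) * χ (U (φ a) (φ b))
      χ-trace a b = trans (χ-∧ (U (φ a) (φ b)) (adj F a b)) (*-comm (χ (U (φ a) (φ b))) (χ (adj F a b)))
      trace-sym : ∀ a b → trace F φ U a b ≡ trace F φ U b a
      trace-sym a b = cong₂ _∧_ (U-sym (φ a) (φ b)) (SimpleGraph.sym F a b)
      trace-irr : ∀ a → trace F φ U a a ≡ false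
      trace-irr a = trans (cong (U (φ a) (φ a) ∧_) (irrefl F a)) (∧-zeroʳ _)

module _ {r n} (F : SimpleGraph r) {φ : Fin r → Fin n} where

  EdgeIn-sym : ∀ {u w} → EdgeIn F φ u w → EdgeIn F φ w u
  EdgeIn-sym (a , b , Fab , φa≡u , φb≡w) = b , a , trans (SimpleGraph.sym F b a) Fab , φb≡w , φa≡u

  EdgeIn-ends : ∀ {u w} → EdgeIn F φ u w → InImg φ u × InImg φ w
  EdgeIn-ends (a , b , _ , φa≡u , φb≡w) = (a , φa≡u) , (b , φb≡w)

  EdgeIn-≢ : Injective _≡_ _≡_ φ → ∀ {u w} → EdgeIn F φ u w → u ≢ w
  EdgeIn-≢ φ-inj (a , b , Fab , refl , refl) φa≡φb = adj⇒≢ F Fab (φ-inj φa≡φb)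

swap-Common : ∀ {r n} {φ ψ : Fin r → Fin n} {u} → Common φ ψ u → Common ψ φ u
swap-Common (u∈φ , u∈ψ) = u∈ψ , u∈φ

module Copies {r n k} (F : SimpleGraph r) (h : Fin k → Fin r → Fin n)
  (h-inj : ∀ i → Injective _≡_ _≡_ (h i)) where

  multiplicity : Fin n → ℕ
  multiplicity u = ∑[ i < k ] fiberSize (h i) u

  arcMultiplicity : Fin n → Fin n → ℕ
  arcMultiplicity u w = ∑[ i < k ] arcFiberSize F (h i) u w

  ∑-multiplicity : ∑[ u < n ] multiplicity u ≡ k * r
  ∑-multiplicity = trans (∑-comm _) (trans (∑-cong (λ i → ∑-fiberSize)) (∑-const k r))

  ∑∑-arcMultiplicity : ∑[ u < n ] ∑[ w < n ] arcMultiplicity u w ≡ k * (2 * edgeCount (adj F))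
  ∑∑-arcMultiplicity = begin
    ∑[ u < n ] ∑[ w < n ] ∑[ i < k ] arcFiberSize F (h i) u w ≡⟨ ∑-cong (λ u → ∑-comm _) ⟩
    ∑[ u < n ] ∑[ i < k ] ∑[ w < n ] arcFiberSize F (h i) u w ≡⟨ ∑-comm _ ⟩
    ∑[ i < k ] ∑[ u < n ] ∑[ w < n ] arcFiberSize F (h i) u w ≡⟨ ∑-cong (λ i → ∑∑-arcFiberSize F) ⟩
    ∑[ i < k ] (2 * edgeCount (adj F))                        ≡⟨ ∑-const k _ ⟩
    k * (2 * edgeCount (adj F))                               ∎
    where open ≡-Reasoning

  arcMultiplicity-pos⇒EdgeIn : ∀ {u w} → 1 ≤ arcMultiplicity u w → ∃[ i ] EdgeIn F (h i) u w
  arcMultiplicity-pos⇒EdgeIn pos with ∑-pos⇒∃ _ pos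
  ... | i , pos′ = i , arcFiberSize-pos⇒EdgeIn F pos′

  EdgeIn⇒arcMultiplicity-pos : ∀ {i u w} → EdgeIn F (h i) u w → 1 ≤ arcMultiplicity u w
  EdgeIn⇒arcMultiplicity-pos {i} {u} {w} uw∈hi =
    ≤-trans (≤-reflexive (sym (EdgeIn⇒arcFiberSize≡1 (h-inj i) F uw∈hi)))
            (term≤∑ (λ j → arcFiberSize F (h j) u w) i)

  module Traces (V : Fin n → Bool) (U : Fin n → Fin n → Bool)
    (U-sym : ∀ u w → U u w ≡ U w u) (U-irr : ∀ u → U u u ≡ false)
    (U⊆V : ∀ u w → U u w ≡ true → V u ≡ true × V w ≡ true) where

    copy : Fin k → Subgraph F
    copy i = record
      { W     = V ∘ h i
      ; E     = trace F (h i) U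
      ; E-sym = λ a b → cong₂ _∧_ (U-sym (h i a) (h i b)) (SimpleGraph.sym F a b)
      ; E⊆F   = λ a b Eab → proj₂ (∧-true⇒ Eab)
      ; E⊆W   = λ a b Eab → U⊆V (h i a) (h i b) (proj₁ (∧-true⇒ Eab))
      }

    copyVertices : Fin k → ℕ
    copyVertices i = vcount (V ∘ h i)

    copyEdges : Fin k → ℕ
    copyEdges i = edgeCount (trace F (h i) U)

    ∑copyVertices≡∑multiplicity : ∑[ i < k ] copyVertices i ≡ ∑[ u < n ] (multiplicity u * χ (V u))
    ∑copyVertices≡∑multiplicity = begin
      ∑[ i < k ] copyVertices i                           ≡⟨ ∑-cong (λ i → vcount-∘ V) ⟩
      ∑[ i < k ] ∑[ u < n ] (fiberSize (h i) u * χ (V u)) ≡⟨ ∑-comm _ ⟩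
      ∑[ u < n ] ∑[ i < k ] (fiberSize (h i) u * χ (V u)) ≡⟨ ∑-cong (λ u → ∑-*ʳ (χ (V u)) _) ⟩
      ∑[ u < n ] (multiplicity u * χ (V u))               ∎
      where open ≡-Reasoning

    2*∑copyEdges : 2 * ∑[ i < k ] copyEdges i ≡ ∑[ u < n ] ∑[ w < n ] (arcMultiplicity u w * χ (U u w))
    2*∑copyEdges = begin
      2 * ∑[ i < k ] copyEdges i
        ≡⟨ ∑-*ˡ 2 copyEdges ⟨
      ∑[ i < k ] (2 * copyEdges i)
        ≡⟨ ∑-cong (λ i → 2*edgeCount-trace F U U-sym) ⟩
      ∑[ i < k ] ∑[ u < n ] ∑[ w < n ] (arcFiberSize F (h i) u w * χ (U u w))
        ≡⟨ ∑-comm _ ⟩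
      ∑[ u < n ] ∑[ i < k ] ∑[ w < n ] (arcFiberSize F (h i) u w * χ (U u w))
        ≡⟨ ∑-cong (λ u → ∑-comm _) ⟩
      ∑[ u < n ] ∑[ w < n ] ∑[ i < k ] (arcFiberSize F (h i) u w * χ (U u w))
        ≡⟨ ∑-cong (λ u → ∑-cong (λ w → ∑-*ʳ (χ (U u w)) _)) ⟩
      ∑[ u < n ] ∑[ w < n ] (arcMultiplicity u w * χ (U u w))
        ∎
      where open ≡-Reasoning

    edgeCount≤∑copyEdges : (∀ u w → U u w ≡ true → ∃[ i ] EdgeIn F (h i) u w) →
                           edgeCount U ≤ ∑[ i < k ] copyEdges i
    edgeCount≤∑copyEdges U⊆copies = *-cancelˡ-≤ 2 (begin
      2 * edgeCount U                                         ≡⟨ arcCount≡2*edgeCount U U-sym U-irr ⟨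
      arcCount U                                              ≤⟨ ∑-mono-≤ (λ u → ∑-mono-≤ (χU≤ u)) ⟩
      ∑[ u < n ] ∑[ w < n ] (arcMultiplicity u w * χ (U u w)) ≡⟨ 2*∑copyEdges ⟨
      2 * ∑[ i < k ] copyEdges i                              ∎)
      where
      open ≤-Reasoning
      χU≤ : ∀ u w → χ (U u w) ≤ arcMultiplicity u w * χ (U u w)
      χU≤ u w with U u w in Uuw
      ... | false = z≤n
      ... | true  = subst (1 ≤_) (sym (*-identityʳ _)) (EdgeIn⇒arcMultiplicity-pos (proj₂ (U⊆copies u w Uuw)))

    private
      m q : ℕ
      m = edgeCount (adj F)
      q = r ∸ 1

      ∑-split : ∑[ i < k ] (copyEdges i * q + m * (copyVertices i ⊓ 1)) ≡
                (∑[ i < k ] copyEdges i) * q + m * ∑[ i < k ] (copyVertices i ⊓ 1)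
      ∑-split = trans (∑-distrib-+ _ _) (cong₂ _+_ (∑-*ʳ q copyEdges) (∑-*ˡ m (λ i → copyVertices i ⊓ 1)))

    module _ (bal : Strictly1Balanced F) where

      ∑-density-≤ : (∑[ i < k ] copyEdges i) * q + m * ∑[ i < k ] (copyVertices i ⊓ 1) ≤
                    m * ∑[ i < k ] copyVertices i
      ∑-density-≤ = subst₂ _≤_ ∑-split (∑-*ˡ m copyVertices) (∑-mono-≤ (λ i → density-≤ bal (copy i)))

      ∑-density-< : ∀ i → 2 ≤ copyVertices i → ¬ Subgraph.IsWhole (copy i) →
                    (∑[ i < k ] copyEdges i) * q + m * ∑[ i < k ] (copyVertices i ⊓ 1) <
                    m * ∑[ i < k ] copyVertices i
      ∑-density-< i 2≤xᵢ notWhole =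
        subst₂ _<_ ∑-split (∑-*ˡ m copyVertices)
               (∑-mono-< (λ j → density-≤ bal (copy j)) i (density-< bal (copy i) 2≤xᵢ notWhole))

module HostEdges {r n k} (F : SimpleGraph r) {h : Fin k → Fin r → Fin n} (h-inj : ∀ i → Injective _≡_ _≡_ (h i))
  (U : Fin n → Fin n → Bool) (U-sym : ∀ u w → U u w ≡ U w u) (U-irr : ∀ u → U u u ≡ false)
  (copies⊆U : ∀ {i u w} → EdgeIn F (h i) u w → U u w ≡ true) where

  open Copies F h h-inj

  private
    m : ℕ
    m = edgeCount (adj F)

  arcMultiplicity≤1⇒≤χ : ∀ {u w} → arcMultiplicity u w ≤ 1 → arcMultiplicity u w ≤ χ (U u w)
  arcMultiplicity≤1⇒≤χ {u} {w} ≤1 with U u w in Uuw | arcMultiplicity u w in μ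
  ... | true  | _     = ≤1
  ... | false | zero  = z≤n
  ... | false | suc _
    with () ← trans (sym Uuw) (copies⊆U (proj₂ (arcMultiplicity-pos⇒EdgeIn (subst (1 ≤_) (sym μ) (s≤s z≤n)))))

  k*[2*m]≤2*edgeCount+excess : (ε : Fin n → Fin n → ℕ) →
                               (∀ u w → arcMultiplicity u w ≤ χ (U u w) + ε u w) →
                               k * (2 * m) ≤ 2 * edgeCount U + ∑[ u < n ] ∑[ w < n ] ε u w
  k*[2*m]≤2*edgeCount+excess ε μ≤ = begin
    k * (2 * m)                                          ≡⟨ ∑∑-arcMultiplicity ⟨
    ∑[ u < n ] ∑[ w < n ] arcMultiplicity u w            ≤⟨ ∑-mono-≤ (λ u → ∑-mono-≤ (μ≤ u)) ⟩
    ∑[ u < n ] ∑[ w < n ] (χ (U u w) + ε u w)            ≡⟨ ∑-cong (λ u → ∑-distrib-+ _ _) ⟩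
    ∑[ u < n ] (∑[ w < n ] χ (U u w) + ∑[ w < n ] ε u w) ≡⟨ ∑-distrib-+ _ _ ⟩
    arcCount U + ∑[ u < n ] ∑[ w < n ] ε u w             ≡⟨ cong (_+ _) (arcCount≡2*edgeCount U U-sym U-irr) ⟩
    2 * edgeCount U + ∑[ u < n ] ∑[ w < n ] ε u w        ∎
    where open ≤-Reasoning

  edgeDisjoint⇒k*m≤edgeCount : (∀ {i j u w} → EdgeIn F (h i) u w → EdgeIn F (h j) u w → i ≡ j) →
                               k * m ≤ edgeCount U
  edgeDisjoint⇒k*m≤edgeCount disjoint = *-cancelˡ-≤ 2 (begin
    2 * (k * m)                               ≡⟨ x∙yz≈y∙xz 2 k m ⟩
    k * (2 * m)                               ≤⟨ k*[2*m]≤2*edgeCount+excess (λ _ _ → 0) μ≤ ⟩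
    2 * edgeCount U + ∑[ u < n ] ∑[ w < n ] 0 ≡⟨ cong (2 * edgeCount U +_) (∑-zero (λ u → ∑-zero (λ w → refl))) ⟩
    2 * edgeCount U + 0                       ≡⟨ +-identityʳ _ ⟩
    2 * edgeCount U                           ∎)
    where
    open ≤-Reasoning
    unique : ∀ u w i j → 1 ≤ arcFiberSize F (h i) u w → 1 ≤ arcFiberSize F (h j) u w → i ≡ j
    unique u w i j uw∈hi uw∈hj = disjoint (arcFiberSize-pos⇒EdgeIn F uw∈hi) (arcFiberSize-pos⇒EdgeIn F uw∈hj)
    μ≤ : ∀ u w → arcMultiplicity u w ≤ χ (U u w) + 0
    μ≤ u w = ≤-trans (arcMultiplicity≤1⇒≤χ (∑≤1 _ (λ i → arcFiberSize≤1 (h-inj i) F u w) (unique u w)))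
                     (m≤m+n _ 0)

cancel-gap-< : ∀ {a b m p j} → a + m * p ≤ b + m * j → j < p → 1 ≤ m → a < b
cancel-gap-< {a} {b} {m@(suc _)} {p} {j} le j<p _ = +-cancelʳ-< (m * j) a b (begin-strict
  a + m * j <⟨ +-monoʳ-< a (*-monoʳ-< m j<p) ⟩
  a + m * p ≤⟨ le ⟩
  b + m * j ∎)
  where open ≤-Reasoning

cancel-gap-≤ : ∀ {a b m p j} → a + m * p < b + m * j → j ≤ p → a < b
cancel-gap-≤ {a} {b} {m} {p} {j} lt j≤p = +-cancelʳ-< (m * j) a b (begin-strict
  a + m * j ≤⟨ +-monoʳ-≤ a (*-monoʳ-≤ m j≤p) ⟩
  a + m * p <⟨ lt ⟩
  b + m * j ∎)
  where open ≤-Reasoning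

-- v i is shared by h i and h (next i). For a clean cycle of length 2, next swaps the two
-- F-edges and v 0, v 1 are their two shared vertices.
record CyclicJunctions {r n k} (h : Fin k → Fin r → Fin n) : Set where
  field
    2≤k         : 2 ≤ k
    v           : Fin k → Fin n
    v-injective : Injective _≡_ _≡_ v
    v-shared    : ∀ i → Common (h i) (h (next i)) (v i)
    common⊆v    : ∀ i j → i ≢ j → ∀ u → Common (h i) (h j) u → u ≡ v i ⊎ u ≡ v j

module Junctions {r n k} (F : SimpleGraph r) {h : Fin k → Fin r → Fin n} (h-inj : ∀ i → Injective _≡_ _≡_ (h i))
  (J : CyclicJunctions h) (cover : ∀ u → ∃[ i ] InImg (h i) u) where

  open Copies F h h-inj
  open CyclicJunctions J

  junctionCount : Fin n → ℕ
  junctionCount = fiberSize v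

  v∈h : ∀ i → InImg (h i) (v i)
  v∈h i = proj₁ (v-shared i)

  v∈h-next : ∀ i → InImg (h (next i)) (v i)
  v∈h-next i = proj₂ (v-shared i)

  -- h i contains u either as its junction v i or as a stray vertex, and by common⊆v a vertex
  -- is a stray of at most one F-edge.
  multiplicity≤ : ∀ u → multiplicity u ≤ 1 + junctionCount u
  multiplicity≤ u = begin
    multiplicity u                            ≤⟨ ∑-mono-≤ (λ i → m≤n+m∸n (fiberSize (h i) u) (δ (v i) u)) ⟩
    ∑[ i < k ] (δ (v i) u + stray i)          ≡⟨ ∑-distrib-+ _ _ ⟩
    ∑[ i < k ] δ (v i) u + ∑[ i < k ] stray i ≡⟨ cong (_+ ∑[ i < k ] stray i) junctionCount≡∑δ ⟨
    junctionCount u + ∑[ i < k ] stray i      ≤⟨ +-monoʳ-≤ (junctionCount u) (∑≤1 stray stray≤1 stray-unique) ⟩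
    junctionCount u + 1                       ≡⟨ +-comm (junctionCount u) 1 ⟩
    1 + junctionCount u                       ∎
    where
    open ≤-Reasoning
    stray : Fin k → ℕ
    stray i = fiberSize (h i) u ∸ δ (v i) u
    junctionCount≡∑δ : junctionCount u ≡ ∑[ i < k ] δ (v i) u
    junctionCount≡∑δ = trans (pushforward-def v _ u) (∑-cong (λ i → *-identityʳ _))
    stray≤1 : ∀ i → stray i ≤ 1
    stray≤1 i = ≤-trans (m∸n≤m _ (δ (v i) u)) (fiberSize≤1 (h-inj i) u)
    stray-pos : ∀ i → 1 ≤ stray i → InImg (h i) u × v i ≢ u
    stray-pos i pos = fiberSize-pos⇒InImg (≤-trans pos (m∸n≤m _ (δ (v i) u))) , vi≢u
      where
      vi≢u : v i ≢ u
      vi≢u refl with () ← ≤-trans pos (begin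
        fiberSize (h i) (v i) ∸ δ (v i) (v i) ≡⟨ cong (fiberSize (h i) (v i) ∸_) (δ-refl (v i)) ⟩
        fiberSize (h i) (v i) ∸ 1             ≤⟨ ∸-monoˡ-≤ 1 (fiberSize≤1 (h-inj i) (v i)) ⟩
        0                                     ∎)
    stray-unique : ∀ i j → 1 ≤ stray i → 1 ≤ stray j → i ≡ j
    stray-unique i j si sj with i ≟ᶠ j
    ... | yes i≡j = i≡j
    ... | no i≢j with stray-pos i si | stray-pos j sj
    ...   | u∈hi , vi≢u | u∈hj , vj≢u with common⊆v i j i≢j u (u∈hi , u∈hj)
    ...     | inj₁ u≡vi = ⊥-elim (vi≢u (sym u≡vi))
    ...     | inj₂ u≡vj = ⊥-elim (vj≢u (sym u≡vj))

  ∈copy⇒1≤multiplicity : ∀ {i u} → InImg (h i) u → 1 ≤ multiplicity u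
  ∈copy⇒1≤multiplicity {i} {u} u∈hi =
    ≤-trans (≤-reflexive (sym (InImg⇒fiberSize≡1 (h-inj i) u∈hi))) (term≤∑ (λ j → fiberSize (h j) u) i)

  junctionCount≡0⊎∈v : ∀ u → junctionCount u ≡ 0 ⊎ InImg v u
  junctionCount≡0⊎∈v u with junctionCount u in ju
  ... | zero  = inj₁ refl
  ... | suc _ = inj₂ (fiberSize-pos⇒InImg (subst (1 ≤_) (sym ju) (s≤s z≤n)))

  multiplicity≥ : ∀ u → 1 + junctionCount u ≤ multiplicity u
  multiplicity≥ u with junctionCount≡0⊎∈v u
  ... | inj₁ ju≡0 rewrite ju≡0 = ∈copy⇒1≤multiplicity (proj₂ (cover u))
  ... | inj₂ (i , refl) = begin
    1 + junctionCount (v i)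
      ≤⟨ +-monoʳ-≤ 1 (fiberSize≤1 v-injective (v i)) ⟩
    2
      ≡⟨ cong₂ _+_ (InImg⇒fiberSize≡1 (h-inj i) (v∈h i))
                   (InImg⇒fiberSize≡1 (h-inj (next i)) (v∈h-next i)) ⟨
    fiberSize (h i) (v i) + fiberSize (h (next i)) (v i)
      ≤⟨ two-terms≤∑ (λ j → fiberSize (h j) (v i)) (λ i≡next → next-≢ 2≤k i (sym i≡next)) ⟩
    multiplicity (v i)
      ∎
    where open ≤-Reasoning

  multiplicity≡ : ∀ u → multiplicity u ≡ 1 + junctionCount u
  multiplicity≡ u = ≤-antisym (multiplicity≤ u) (multiplicity≥ u)

  vertexCount : 1 ≤ r → n ≡ k * (r ∸ 1)
  vertexCount 1≤r = +-cancelʳ-≡ k n (k * (r ∸ 1)) (begin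
    n + k                                     ≡⟨ cong₂ _+_ (trans (∑-const n 1) (*-identityʳ n)) ∑-fiberSize ⟨
    ∑[ u < n ] 1 + ∑[ u < n ] junctionCount u ≡⟨ ∑-distrib-+ _ _ ⟨
    ∑[ u < n ] (1 + junctionCount u)          ≡⟨ ∑-cong multiplicity≡ ⟨
    ∑[ u < n ] multiplicity u                 ≡⟨ ∑-multiplicity ⟩
    k * r                                     ≡⟨ cong (k *_) (trans (+-comm 1 (r ∸ 1)) (m∸n+n≡m 1≤r)) ⟨
    k * (1 + (r ∸ 1))                         ≡⟨ *-suc k (r ∸ 1) ⟩
    k + k * (r ∸ 1)                           ≡⟨ +-comm k _ ⟩
    k * (r ∸ 1) + k                           ∎)
    where open ≡-Reasoning

  module Occupancy (V : Fin n → Bool) (U : Fin n → Fin n → Bool)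
    (U-sym : ∀ u w → U u w ≡ U w u) (U-irr : ∀ u → U u u ≡ false)
    (U⊆V : ∀ u w → U u w ≡ true → V u ≡ true × V w ≡ true) where

    open Traces V U U-sym U-irr U⊆V

    ∑copyVertices≡ : ∑[ i < k ] copyVertices i ≡ vcount V + ∑[ i < k ] χ (V (v i))
    ∑copyVertices≡ = begin
      ∑[ i < k ] copyVertices i
        ≡⟨ ∑copyVertices≡∑multiplicity ⟩
      ∑[ u < n ] (multiplicity u * χ (V u))
        ≡⟨ ∑-cong (λ u → cong (_* χ (V u)) (multiplicity≡ u)) ⟩
      ∑[ u < n ] (χ (V u) + junctionCount u * χ (V u))
        ≡⟨ ∑-distrib-+ _ _ ⟩
      ∑[ u < n ] χ (V u) + ∑[ u < n ] (junctionCount u * χ (V u))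
        ≡⟨ cong₂ _+_ vcount-∑ (∑-pushforward v (λ _ → 1) (χ ∘ V)) ⟨
      vcount V + ∑[ i < k ] (1 * χ (V (v i)))
        ≡⟨ cong (vcount V +_) (∑-cong (λ i → *-identityˡ _)) ⟩
      vcount V + ∑[ i < k ] χ (V (v i))
        ∎
      where open ≡-Reasoning

    ∈V⇒1≤copyVertices : ∀ {i u} → InImg (h i) u → V u ≡ true → 1 ≤ copyVertices i
    ∈V⇒1≤copyVertices {i} (a , refl) Vu = 1≤vcount {W = V ∘ h i} Vu

    junction≤occupied : ∀ i → χ (V (v i)) ≤ copyVertices i ⊓ 1
    junction≤occupied i with V (v i) in Vvi
    ... | false = z≤n
    ... | true  = ≤-reflexive (sym (m≥n⇒m⊓n≡n (∈V⇒1≤copyVertices (v∈h i) Vvi)))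

    -- If every occupied copy has its junction in V, occupancy spreads around the cycle through
    -- v i ∈ h (next i), and then each h i contains the two junctions v i and v (prev i) in V.
    unoccupiedJunction⊎2≤copyVertices : 1 ≤ vcount V →
      (∃[ i ] χ (V (v i)) < copyVertices i ⊓ 1) ⊎ (∀ i → 2 ≤ copyVertices i)
    unoccupiedJunction⊎2≤copyVertices 1≤vcountV
      with Finₚ.any? (λ i → (V (v i) ≟ᵇ false) ×-dec (1 ≤? copyVertices i))
    ... | yes (i , Vvi≡false , 1≤xᵢ) =
      inj₁ (i , subst₂ _<_ (cong χ (sym Vvi≡false)) (sym (m≥n⇒m⊓n≡n 1≤xᵢ)) (s≤s z≤n))
    ... | no noneUnoccupied = inj₂ 2≤copyVertices
      where
      occupied⇒V : ∀ i → 1 ≤ copyVertices i → V (v i) ≡ true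
      occupied⇒V i 1≤xᵢ with V (v i) in Vvi
      ... | true  = refl
      ... | false = ⊥-elim (noneUnoccupied (i , Vvi , 1≤xᵢ))
      step : ∀ i → 1 ≤ copyVertices i → 1 ≤ copyVertices (next i)
      step i 1≤xᵢ = ∈V⇒1≤copyVertices (v∈h-next i) (occupied⇒V i 1≤xᵢ)
      start : ∃[ i ] 1 ≤ copyVertices i
      start with vcount-pos⇒∃ 1≤vcountV
      ... | u , Vu = proj₁ (cover u) , ∈V⇒1≤copyVertices (proj₂ (cover u)) Vu
      occupied : ∀ i → 1 ≤ copyVertices i
      occupied = cycle-induction (λ i → 1 ≤ copyVertices i) step (proj₂ start)
      2≤copyVertices : ∀ i → 2 ≤ copyVertices i
      2≤copyVertices i with next-surjective i
      ... | p , refl with v∈h (next p) | v∈h-next p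
      ...   | a , ha≡v[next-p] | b , hb≡v[p] = 2≤vcount {W = V ∘ h (next p)} a≢b
        (trans (cong V ha≡v[next-p]) (occupied⇒V (next p) (occupied (next p))))
        (trans (cong V hb≡v[p]) (occupied⇒V p (occupied p)))
        where
        a≢b : a ≢ b
        a≢b a≡b = next-≢ 2≤k p (v-injective (trans (sym ha≡v[next-p]) (trans (cong (h (next p)) a≡b) hb≡v[p])))

    module _ (bal : Strictly1Balanced F) (1≤m : 1 ≤ edgeCount (adj F))
      (U⊆copies : ∀ u w → U u w ≡ true → ∃[ i ] EdgeIn F (h i) u w) where

      private
        m q P J′ : ℕ
        m  = edgeCount (adj F)
        q  = r ∸ 1
        P  = ∑[ i < k ] (copyVertices i ⊓ 1)
        J′ = ∑[ i < k ] χ (V (v i))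

        edges≤ : edgeCount U * q + m * P ≤ (∑[ i < k ] copyEdges i) * q + m * P
        edges≤ = +-monoˡ-≤ (m * P) (*-monoˡ-≤ q (edgeCount≤∑copyEdges U⊆copies))

        m*∑copyVertices≡ : m * ∑[ i < k ] copyVertices i ≡ m * vcount V + m * J′
        m*∑copyVertices≡ = trans (cong (m *_) ∑copyVertices≡) (*-distribˡ-+ m (vcount V) J′)

      subgraph-density-< : 1 ≤ vcount V → ¬ (∀ i → Subgraph.IsWhole (copy i)) → edgeCount U * q < m * vcount V
      subgraph-density-< 1≤vcountV notAllWhole with unoccupiedJunction⊎2≤copyVertices 1≤vcountV
      ... | inj₁ (i , unoccupied) =
        cancel-gap-< {m = m} (≤-trans edges≤ (≤-trans (∑-density-≤ bal) (≤-reflexive m*∑copyVertices≡)))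
                     (∑-mono-< junction≤occupied i unoccupied) 1≤m
      ... | inj₂ 2≤copyVertices with Finₚ.¬∀⟶∃¬ k _ (λ i → Subgraph.isWhole? (copy i)) notAllWhole
      ...   | i , notWhole =
        cancel-gap-≤ {m = m} (≤-<-trans edges≤ (<-≤-trans (∑-density-< bal i (2≤copyVertices i) notWhole)
                                                            (≤-reflexive m*∑copyVertices≡)))
                     (∑-mono-≤ junction≤occupied)

module LongCycle {r n k} {h : Fin k → Fin r → Fin n} (long : LongShape k h) where

  private
    v : Fin k → Fin n
    v = proj₁ (proj₁ (proj₂ long))

    common-next : ∀ i u → Common (h i) (h (next i)) u ⇔ (u ≡ v i)
    common-next = proj₂ (proj₂ (proj₁ (proj₂ long)))

    disjoint : ∀ i j → i ≢ j → j ≢ next i → i ≢ next j → ∀ u → ¬ Common (h i) (h j) u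
    disjoint = proj₂ (proj₂ long)

  common-single : ∀ i j → i ≢ j → ∃[ c ] (c ≡ v i ⊎ c ≡ v j) × (∀ u → Common (h i) (h j) u → u ≡ c)
  common-single i j i≢j with j ≟ᶠ next i
  ... | yes refl = v i , inj₁ refl , λ u → Equivalence.to (common-next i u)
  ... | no j≢next[i] with i ≟ᶠ next j
  ...   | yes refl     = v j , inj₂ refl , λ u → Equivalence.to (common-next j u) ∘ swap-Common
  ...   | no i≢next[j] = v i , inj₁ refl , λ u c → ⊥-elim (disjoint i j i≢j j≢next[i] i≢next[j] u c)

  common-unique : ∀ i j → i ≢ j → ∀ {u w} → Common (h i) (h j) u → Common (h i) (h j) w → u ≡ w
  common-unique i j i≢j cu cw with common-single i j i≢j
  ... | c , _ , only-c = trans (only-c _ cu) (sym (only-c _ cw))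

  cyclicJunctions : CyclicJunctions h
  cyclicJunctions = record
    { 2≤k         = <⇒≤ (proj₁ long)
    ; v           = v
    ; v-injective = proj₁ (proj₂ (proj₁ (proj₂ long)))
    ; v-shared    = λ i → Equivalence.from (common-next i (v i)) refl
    ; common⊆v    = λ i j i≢j → common⊆v (common-single i j i≢j)
    }
    where
    common⊆v : ∀ {i j} → ∃[ c ] (c ≡ v i ⊎ c ≡ v j) × (∀ u → Common (h i) (h j) u → u ≡ c) →
               ∀ u → Common (h i) (h j) u → u ≡ v i ⊎ u ≡ v j
    common⊆v (c , inj₁ refl , only-c) u cu = inj₁ (only-c u cu)
    common⊆v (c , inj₂ refl , only-c) u cu = inj₂ (only-c u cu)

+≤1 : ∀ {a b} → a ≤ 1 → b ≤ 1 → (1 ≤ a → 1 ≤ b → ⊥) → a + b ≤ 1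
+≤1 {zero}          _   b≤1 _    = b≤1
+≤1 {suc _} {zero}  a≤1 _   _    = ≤-trans (≤-reflexive (+-identityʳ _)) a≤1
+≤1 {suc _} {suc _} _   _   both = ⊥-elim (both (s≤s z≤n) (s≤s z≤n))

module TwoCycle {r n} {F : SimpleGraph r} {h : Fin 2 → Fin r → Fin n} (h-inj : ∀ i → Injective _≡_ _≡_ (h i))
  (two : TwoShape 2 h) where

  private
    shared : ∃[ v₁ ] ∃[ v₂ ] (v₁ ≢ v₂ ×
               (∀ u → Common (h zero) (h (suc zero)) u ⇔ (u ≡ v₁ ⊎ u ≡ v₂)))
    shared = proj₂ two zero (suc zero) (λ ())

    v₁ v₂ : Fin n
    v₁ = proj₁ shared
    v₂ = proj₁ (proj₂ shared)

    common : ∀ u → Common (h zero) (h (suc zero)) u ⇔ (u ≡ v₁ ⊎ u ≡ v₂)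
    common = proj₂ (proj₂ (proj₂ shared))

  common-pair : ∀ i j → i ≢ j → ∀ {x} → Common (h i) (h j) x → x ≡ v₁ ⊎ x ≡ v₂
  common-pair zero       zero       i≢j = ⊥-elim (i≢j refl)
  common-pair (suc zero) (suc zero) i≢j = ⊥-elim (i≢j refl)
  common-pair zero       (suc zero) _ c = Equivalence.to (common _) c
  common-pair (suc zero) zero       _ c = Equivalence.to (common _) (swap-Common c)

  cyclicJunctions : CyclicJunctions h
  cyclicJunctions = record
    { 2≤k         = ≤-refl
    ; v           = v
    ; v-injective = v-injective
    ; v-shared    = v-shared
    ; common⊆v    = common⊆v
    }
    where
    v : Fin 2 → Fin n
    v zero       = v₁
    v (suc zero) = v₂
    v-injective : Injective _≡_ _≡_ v
    v-injective {zero}     {zero}     _     = refl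
    v-injective {zero}     {suc zero} v₁≡v₂ = ⊥-elim (proj₁ (proj₂ (proj₂ shared)) v₁≡v₂)
    v-injective {suc zero} {zero}     v₂≡v₁ = ⊥-elim (proj₁ (proj₂ (proj₂ shared)) (sym v₂≡v₁))
    v-injective {suc zero} {suc zero} _     = refl
    v-shared : ∀ i → Common (h i) (h (next i)) (v i)
    v-shared zero       = Equivalence.from (common v₁) (inj₁ refl)
    v-shared (suc zero) = swap-Common (Equivalence.from (common v₂) (inj₂ refl))
    common⊆v : ∀ i j → i ≢ j → ∀ u → Common (h i) (h j) u → u ≡ v i ⊎ u ≡ v j
    common⊆v zero       (suc zero) i≢j u c = common-pair zero (suc zero) i≢j c
    common⊆v (suc zero) zero       i≢j u c = swap (common-pair (suc zero) zero i≢j c)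
    common⊆v zero       zero       i≢j     = ⊥-elim (i≢j refl)
    common⊆v (suc zero) (suc zero) i≢j     = ⊥-elim (i≢j refl)

  private
    shared-ends : ∀ {u w} → EdgeIn F (h zero) u w → EdgeIn F (h (suc zero)) u w →
                  (u ≡ v₁ ⊎ u ≡ v₂) × (w ≡ v₁ ⊎ w ≡ v₂)
    shared-ends E₀ E₁ with EdgeIn-ends F E₀ | EdgeIn-ends F E₁
    ... | u∈h₀ , w∈h₀ | u∈h₁ , w∈h₁ =
      common-pair zero (suc zero) (λ ()) (u∈h₀ , u∈h₁) , common-pair zero (suc zero) (λ ()) (w∈h₀ , w∈h₁)

    other-end : ∀ {A : Set} {a b u w x : A} → u ≢ w → (u ≡ a ⊎ u ≡ b) → (w ≡ a ⊎ w ≡ b) →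
                (x ≡ a ⊎ x ≡ b) → x ≡ u ⊎ x ≡ w
    other-end u≢w (inj₁ refl) (inj₁ refl) _           = ⊥-elim (u≢w refl)
    other-end u≢w (inj₂ refl) (inj₂ refl) _           = ⊥-elim (u≢w refl)
    other-end _   (inj₁ refl) (inj₂ refl) (inj₁ refl) = inj₁ refl
    other-end _   (inj₁ refl) (inj₂ refl) (inj₂ refl) = inj₂ refl
    other-end _   (inj₂ refl) (inj₁ refl) (inj₁ refl) = inj₂ refl
    other-end _   (inj₂ refl) (inj₁ refl) (inj₂ refl) = inj₁ refl

    edge-on-ends : ∀ {φ : Fin r → Fin n} {u w u′ w′} → u′ ≢ w′ →
                   (u′ ≡ u ⊎ u′ ≡ w) → (w′ ≡ u ⊎ w′ ≡ w) → EdgeIn F φ u w → EdgeIn F φ u′ w′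
    edge-on-ends u′≢w′ (inj₁ refl) (inj₁ refl) _ = ⊥-elim (u′≢w′ refl)
    edge-on-ends u′≢w′ (inj₂ refl) (inj₂ refl) _ = ⊥-elim (u′≢w′ refl)
    edge-on-ends _     (inj₁ refl) (inj₂ refl) E = E
    edge-on-ends _     (inj₂ refl) (inj₁ refl) E = EdgeIn-sym F E

  shared⇒sparse : ∀ {u w} → EdgeIn F (h zero) u w → EdgeIn F (h (suc zero)) u w →
    ∀ i j → i ≢ j → ∀ u′ w′ → u′ ≢ w′ →
    Common (h i) (h j) u′ → Common (h i) (h j) w′ → EdgeIn F (h i) u′ w′
  shared⇒sparse {u} {w} E₀ E₁ i j i≢j u′ w′ u′≢w′ cu′ cw′ =
    edge-on-ends u′≢w′ (other-end u≢w u∈v w∈v (common-pair i j i≢j cu′))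
                       (other-end u≢w u∈v w∈v (common-pair i j i≢j cw′)) (E i)
    where
    u≢w : u ≢ w
    u≢w = EdgeIn-≢ F (h-inj zero) E₀
    u∈v : u ≡ v₁ ⊎ u ≡ v₂
    u∈v = proj₁ (shared-ends E₀ E₁)
    w∈v : w ≡ v₁ ⊎ w ≡ v₂
    w∈v = proj₂ (shared-ends E₀ E₁)
    E : ∀ i → EdgeIn F (h i) u w
    E zero       = E₀
    E (suc zero) = E₁

  module _ (U : Fin n → Fin n → Bool) (U-sym : ∀ u w → U u w ≡ U w u) (U-irr : ∀ u → U u u ≡ false)
    (copies⊆U : ∀ {i u w} → EdgeIn F (h i) u w → U u w ≡ true) where

    open Copies F h h-inj
    open HostEdges F h-inj U U-sym U-irr copies⊆U

    private
      -- The ordered pairs (v₁, v₂) and (v₂, v₁): the only edge both F-edges can contain.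
      ε : Fin n → Fin n → ℕ
      ε u w = δ v₁ u * δ v₂ w + δ v₂ u * δ v₁ w

      ∑∑ε : ∑[ u < n ] ∑[ w < n ] ε u w ≡ 2
      ∑∑ε = trans (∑-cong (λ u → ∑-distrib-+ _ _))
                  (trans (∑-distrib-+ _ _) (cong₂ _+_ (∑∑-δδ v₁ v₂) (∑∑-δδ v₂ v₁)))

      ε-pos : ∀ {u w} → u ≢ w → (u ≡ v₁ ⊎ u ≡ v₂) → (w ≡ v₁ ⊎ w ≡ v₂) → 1 ≤ ε u w
      ε-pos u≢w (inj₁ refl) (inj₁ refl) = ⊥-elim (u≢w refl)
      ε-pos u≢w (inj₂ refl) (inj₂ refl) = ⊥-elim (u≢w refl)
      ε-pos _   (inj₁ refl) (inj₂ refl) =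
        ≤-trans (≤-reflexive (sym (cong₂ _*_ (δ-refl v₁) (δ-refl v₂)))) (m≤m+n _ _)
      ε-pos _   (inj₂ refl) (inj₁ refl) =
        ≤-trans (≤-reflexive (sym (cong₂ _*_ (δ-refl v₂) (δ-refl v₁)))) (m≤n+m _ _)

      A₀ A₁ : Fin n → Fin n → ℕ
      A₀ = arcFiberSize F (h zero)
      A₁ = arcFiberSize F (h (suc zero))

      μ≡ : ∀ u w → arcMultiplicity u w ≡ A₀ u w + A₁ u w
      μ≡ u w = ∑-Fin2 (λ i → arcFiberSize F (h i) u w)

      μ≤ : ∀ u w → arcMultiplicity u w ≤ χ (U u w) + ε u w
      μ≤ u w with (1 ≤? A₀ u w) ×-dec (1 ≤? A₁ u w)
      ... | yes (p₀ , p₁) = begin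
        arcMultiplicity u w ≡⟨ μ≡ u w ⟩
        A₀ u w + A₁ u w     ≤⟨ +-mono-≤ (arcFiberSize≤1 (h-inj zero) F u w) A₁≤ε ⟩
        1 + ε u w           ≡⟨ cong (λ b → χ b + ε u w) (copies⊆U E₀) ⟨
        χ (U u w) + ε u w   ∎
        where
        open ≤-Reasoning
        E₀ : EdgeIn F (h zero) u w
        E₀ = arcFiberSize-pos⇒EdgeIn F p₀
        ends : (u ≡ v₁ ⊎ u ≡ v₂) × (w ≡ v₁ ⊎ w ≡ v₂)
        ends = shared-ends E₀ (arcFiberSize-pos⇒EdgeIn F p₁)
        A₁≤ε : A₁ u w ≤ ε u w
        A₁≤ε = ≤-trans (arcFiberSize≤1 (h-inj (suc zero)) F u w)
                       (ε-pos (EdgeIn-≢ F (h-inj zero) E₀) (proj₁ ends) (proj₂ ends))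
      ... | no notBoth = ≤-trans (arcMultiplicity≤1⇒≤χ μ≤1) (m≤m+n _ _)
        where
        μ≤1 : arcMultiplicity u w ≤ 1
        μ≤1 = subst (_≤ 1) (sym (μ≡ u w)) (+≤1 (arcFiberSize≤1 (h-inj zero) F u w)
                                               (arcFiberSize≤1 (h-inj (suc zero)) F u w)
                                               (λ p₀ p₁ → notBoth (p₀ , p₁)))

    2*m≤edgeCount+1 : 2 * edgeCount (adj F) ≤ edgeCount U + 1
    2*m≤edgeCount+1 = *-cancelˡ-≤ 2 (begin
      2 * (2 * edgeCount (adj F))                   ≤⟨ k*[2*m]≤2*edgeCount+excess ε μ≤ ⟩
      2 * edgeCount U + ∑[ u < n ] ∑[ w < n ] ε u w ≡⟨ cong (2 * edgeCount U +_) ∑∑ε ⟩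
      2 * edgeCount U + 2 * 1                       ≡⟨ *-distribˡ-+ 2 (edgeCount U) 1 ⟨
      2 * (edgeCount U + 1)                         ∎)
      where open ≤-Reasoning

⊆[]⇒≡[] : ∀ {A : Set} {xs : List A} → xs ⊆ [] → xs ≡ []
⊆[]⇒≡[] [] = refl

⊆[x]⇒ : ∀ {A : Set} {xs : List A} {x} → xs ⊆ [ x ] → xs ≡ [] ⊎ xs ≡ [ x ]
⊆[x]⇒ (_ ∷ʳ xs⊆[])   = inj₁ (⊆[]⇒≡[] xs⊆[])
⊆[x]⇒ (refl ∷ xs⊆[]) = inj₂ (cong (_ ∷_) (⊆[]⇒≡[] xs⊆[]))

CycleDummies : ∀ {r n} {F : SimpleGraph r} → DGraph F n → CleanFCycle F n → Set
CycleDummies G C = (Dense C × D G ≡ []) ⊎ (Σ (Sparse C) λ sp → D G ≡ [ (C , sp) ])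

cleanCycleJunctions : ∀ {r n} {F : SimpleGraph r} (C : CleanFCycle F n) → CyclicJunctions (h C)
cleanCycleJunctions record { shape = inj₁ long } = LongCycle.cyclicJunctions long
cleanCycleJunctions {F = F} record { emb = emb ; shape = inj₂ two@(refl , _) } = TwoCycle.cyclicJunctions {F = F} emb two

dense⇒edgeDisjoint : ∀ {r n} {F : SimpleGraph r} (C : CleanFCycle F n) → Dense C →
                     ∀ {i j u w} → EdgeIn F (h C i) u w → EdgeIn F (h C j) u w → i ≡ j
dense⇒edgeDisjoint {F = F} record { emb = emb ; shape = inj₁ long } _ {i} {j} Eᵢ Eⱼ with i ≟ᶠ j
... | yes i≡j = i≡j
... | no i≢j  = ⊥-elim (EdgeIn-≢ F (emb i) Eᵢ (LongCycle.common-unique long i j i≢j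
                  (proj₁ (EdgeIn-ends F Eᵢ) , proj₁ (EdgeIn-ends F Eⱼ))
                  (proj₂ (EdgeIn-ends F Eᵢ) , proj₂ (EdgeIn-ends F Eⱼ))))
dense⇒edgeDisjoint record { shape = inj₂ (refl , _) } _ {zero}     {zero}     _ _ = refl
dense⇒edgeDisjoint record { shape = inj₂ (refl , _) } _ {suc zero} {suc zero} _ _ = refl
dense⇒edgeDisjoint {F = F} record { emb = emb ; shape = inj₂ two@(refl , _) } dense {zero} {suc zero} E₀ E₁ =
  ⊥-elim (dense (refl , TwoCycle.shared⇒sparse {F = F} emb two E₀ E₁))
dense⇒edgeDisjoint {F = F} record { emb = emb ; shape = inj₂ two@(refl , _) } dense {suc zero} {zero} E₁ E₀ =
  ⊥-elim (dense (refl , TwoCycle.shared⇒sparse {F = F} emb two E₀ E₁))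

shadow⇒copies⊆U : ∀ {r n} {F : SimpleGraph r} {C : CleanFCycle F n} {U : Fin n → Fin n → Bool} → IsShadow C U →
                  ∀ {i u w} → EdgeIn F (h C i) u w → U u w ≡ true
shadow⇒copies⊆U shadow {i} E = Equivalence.from (proj₂ shadow _ _) (i , E)

k*m≤eG : ∀ {r n} {F : SimpleGraph r} {G : DGraph F n} (C : CleanFCycle F n) → IsShadow C (U G) →
         CycleDummies G C → k C * edgeCount (adj F) ≤ eG G
k*m≤eG {F = F} {G} C shadow (inj₁ (dense , _)) =
  ≤-trans (HostEdges.edgeDisjoint⇒k*m≤edgeCount F (emb C) (U G) (Usym G) (Uirr G) (shadow⇒copies⊆U {C = C} shadow)
                                                 (dense⇒edgeDisjoint C dense))
          (m≤m+n _ _)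
k*m≤eG record { shape = inj₁ (2<k , _) } _ (inj₂ ((k≡2 , _) , _)) = ⊥-elim (<-irrefl (sym k≡2) 2<k)
k*m≤eG {F = F} {G} C@record { emb = emb ; shape = inj₂ two@(refl , _) } shadow (inj₂ (_ , D≡[C])) =
  subst (λ ds → 2 * edgeCount (adj F) ≤ edgeCount (U G) + length ds) (sym D≡[C])
        (TwoCycle.2*m≤edgeCount+1 {F = F} emb two (U G) (Usym G) (Uirr G) (shadow⇒copies⊆U {C = C} shadow))

module CleanDCycle {r} (r>2 : 2 < r) {F : SimpleGraph r} (bal : Strictly1Balanced F) {n} {G : DGraph F n}
  (C : CleanFCycle F n) (shadow : IsShadow C (U G)) (S : SubDGraph G) (1≤vS : 1 ≤ vS S) where

  private
    m : ℕ
    m = edgeCount (adj F)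

    U'-irr : ∀ u → U' S u u ≡ false
    U'-irr u = ⊆-false (U'⊆U S u u) (Uirr G u)

    U'⊆copies : ∀ u w → U' S u w ≡ true → ∃[ i ] EdgeIn F (h C i) u w
    U'⊆copies u w U'uw = Equivalence.to (proj₂ shadow u w) (U'⊆U S u w U'uw)

  open Copies F (h C) (emb C)
  open Traces (V' S) (U' S) (U'sym S) U'-irr (U'in S)
  open Junctions F (emb C) (cleanCycleJunctions C) (proj₁ shadow)
  open Occupancy (V' S) (U' S) (U'sym S) U'-irr (U'in S)

  AllWhole : Set
  AllWhole = ∀ i → Subgraph.IsWhole (copy i)

  allWhole? : Dec AllWhole
  allWhole? = Finₚ.all? (λ i → Subgraph.isWhole? (copy i))

  allWhole⇒spanning : AllWhole → (∀ u → V' S u ≡ true) × (∀ u w → U' S u w ≡ U G u w)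
  allWhole⇒spanning whole = V'-full , U'≗U
    where
    V'-full : ∀ u → V' S u ≡ true
    V'-full u with proj₁ shadow u
    ... | i , a , refl = proj₁ (whole i) a
    U'≗U : ∀ u w → U' S u w ≡ U G u w
    U'≗U u w with U G u w in Uuw
    ... | false = ⊆-false (U'⊆U S u w) Uuw
    ... | true with Equivalence.to (proj₂ shadow u w) Uuw
    ...   | i , a , b , Fab , refl , refl = proj₁ (∧-true⇒ (trans (proj₂ (whole i) a b) Fab))

  eS<eG : ∀ {ds ds′} → D' S ≡ ds → D G ≡ ds′ →
          edgeCount (U' S) + length ds < edgeCount (U G) + length ds′ → eS S < eG G
  eS<eG refl refl lt = lt

  spanning-case : (∀ u → V' S u ≡ true) → eS S < eG G → eS S * vG G < eG G * vS S
  spanning-case V'-full lt =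
    subst (λ ν → eS S * n < eG G * ν) (sym vS≡n) (*-monoˡ-< n {{>-nonZero (subst (1 ≤_) vS≡n 1≤vS)}} lt)
    where
    vS≡n : vS S ≡ n
    vS≡n = vcount-full V'-full

  density-case : k C * m ≤ eG G → D' S ≡ [] → ¬ AllWhole → eS S * vG G < eG G * vS S
  density-case k*m≤ D'≡[] notAllWhole = begin-strict
    eS S * n                           ≡⟨ cong (λ ds → (edgeCount (U' S) + length ds) * n) D'≡[] ⟩
    (edgeCount (U' S) + 0) * n         ≡⟨ cong (_* n) (+-identityʳ (edgeCount (U' S))) ⟩
    edgeCount (U' S) * n               ≡⟨ cong (edgeCount (U' S) *_) (vertexCount (≤-trans (s≤s z≤n) r>2)) ⟩
    edgeCount (U' S) * (k C * (r ∸ 1)) ≡⟨ x∙yz≈y∙xz (edgeCount (U' S)) (k C) (r ∸ 1) ⟩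
    k C * (edgeCount (U' S) * (r ∸ 1)) <⟨ *-monoʳ-< (k C) {{>-nonZero 0<k}} edges-density ⟩
    k C * (m * vS S)                   ≡⟨ *-assoc (k C) m (vS S) ⟨
    k C * m * vS S                     ≤⟨ *-monoˡ-≤ (vS S) k*m≤ ⟩
    eG G * vS S                        ∎
    where
    open ≤-Reasoning
    0<k : 0 < k C
    0<k = ≤-trans (s≤s z≤n) (CyclicJunctions.2≤k (cleanCycleJunctions C))
    edges-density : edgeCount (U' S) * (r ∸ 1) < m * vS S
    edges-density = subgraph-density-< bal (1≤edgeCount {F = F} bal r>2) U'⊆copies 1≤vS notAllWhole

  no-dummy-case : k C * m ≤ eG G → D' S ≡ [] → (AllWhole → eS S < eG G) → eS S * vG G < eG G * vS S
  no-dummy-case k*m≤ D'≡[] allWhole⇒eS<eG with allWhole?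
  ... | no notAllWhole = density-case k*m≤ D'≡[] notAllWhole
  ... | yes allWhole   = spanning-case (proj₁ (allWhole⇒spanning allWhole)) (allWhole⇒eS<eG allWhole)

  strictly-balanced : CycleDummies G C → Proper S → eS S * vG G < eG G * vS S
  strictly-balanced dummies@(inj₁ (_ , D≡[])) proper =
    no-dummy-case (k*m≤eG {G = G} C shadow dummies) D'≡[] λ allWhole →
      ⊥-elim (proper (proj₁ (allWhole⇒spanning allWhole) , proj₂ (allWhole⇒spanning allWhole) ,
                      trans D'≡[] (sym D≡[])))
    where
    D'≡[] : D' S ≡ []
    D'≡[] = ⊆[]⇒≡[] (subst (D' S ⊆_) D≡[] (D'⊆D S))
  strictly-balanced dummies@(inj₂ (_ , D≡[C])) proper with ⊆[x]⇒ (subst (D' S ⊆_) D≡[C] (D'⊆D S))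
  ... | inj₁ D'≡[] = no-dummy-case (k*m≤eG {G = G} C shadow dummies) D'≡[] λ allWhole →
    eS<eG D'≡[] D≡[C] (subst (_< edgeCount (U G) + 1)
                             (sym (trans (+-identityʳ _) (edgeCount-cong (proj₂ (allWhole⇒spanning allWhole)))))
                             (m<m+n (edgeCount (U G)) (s≤s z≤n)))
  ... | inj₂ D'≡[C] = spanning-case V'-full
    (eS<eG D'≡[C] D≡[C] (+-monoˡ-< 1 (edgeCount-< (U'sym S) U'-irr (Usym G) (Uirr G) (U'⊆U S) U'≢U)))
    where
    V'-full : ∀ u → V' S u ≡ true
    V'-full u with subst (All _) D'≡[C] (D'in S)
    ... | C⊆V' ∷ _ = C⊆V' u (proj₁ shadow u)
    U'≢U : ¬ (∀ u w → U' S u w ≡ U G u w)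
    U'≢U U'≗U = proper (V'-full , U'≗U , trans D'≡[C] (sym D≡[C]))

lemma3p4 : (r : ℕ) → 2 < r → (F : SimpleGraph r) → Strictly1Balanced F →
    (n : ℕ) (G : DGraph F n) → IsCleanDCycle G →
    (S : SubDGraph G) → Proper S → 1 ≤ vS S →
    eS S * vG G < eG G * vS S
lemma3p4 r r>2 F bal n G (C , shadow , dummies) S proper 1≤vS =
  CleanDCycle.strictly-balanced r>2 bal C shadow S 1≤vS dummies proper
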